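{- Let $p$ be a prime and $G$ a group of order $p^2$. Then the Laplacian spectrum of the power graph $\mathcal{G}(G)$ is either $0$ with multiplicity $1$ and $p^2$ with multiplicity $p^2-1$, or $0$ with multiplicity $1$, $1$ with multiplicity $p$, $p$ with multiplicity $(p+1)(p-2)$, and $p^2$ with multiplicity $1$.
   Context: The power graph $\mathcal{G}(G)$ has vertex set $G$, distinct $u,v$ adjacent iff one is a positive power of the other. The Laplacian spectrum is the multiset of eigenvalues of $L=D-A$ (degree matrix minus adjacency matrix). -}

module Defs where

open import Level using (Level)
open import Data.Nat as ℕ using (ℕ; zero; suc)
open import Data.Fin using (Fin; zero; suc; toℕ; punchIn)
open import Data.Integer using (ℤ; +_; -_; _+_; _-_; _*_; _^_; 0ℤ; 1ℤ; -1ℤ)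
open import Data.Product using (_×_; ∃)
open import Data.Sum using (_⊎_)
open import Data.List using (List; []; _∷_)
open import Relation.Nullary using (¬_)
open import Relation.Binary.PropositionalEquality using (_≡_)
open import Algebra.Bundles using (Group)

Matrix : ℕ → Set
Matrix n = Fin n → Fin n → ℤ

sumFin : ∀ {n} → (Fin n → ℤ) → ℤ
sumFin {zero}  f = 0ℤ
sumFin {suc n} f = f zero + sumFin (λ i → f (suc i))

δ : ∀ {n} → Fin n → Fin n → ℤ
δ zero    zero    = 1ℤ
δ zero    (suc _) = 0ℤ
δ (suc _) zero    = 0ℤ
δ (suc i) (suc j) = δ i j

det : ∀ {n} → Matrix n → ℤ
det {zero}  M = 1ℤ
det {suc n} M =
  sumFin (λ j → (-1ℤ ^ toℕ j) * (M zero j * det (λ r c → M (suc r) (punchIn j c))))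

charPoly : ∀ {n} → Matrix n → ℤ → ℤ
charPoly L x = det (λ i j → (x * δ i j) - L i j)

-- A (finite) multiset of eigenvalues, given as (eigenvalue, multiplicity) pairs;
-- the associated polynomial ∏ (x - λ)^m evaluated at x
specPoly : List (ℤ × ℕ) → ℤ → ℤ
specPoly []               x = 1ℤ
specPoly ((λ₀ Data.Product., m) ∷ s) x = ((x - λ₀) ^ m) * specPoly s x

-- The spectrum (multiset of eigenvalues, with algebraic multiplicities) of L is S:
-- the characteristic polynomial of L equals ∏ (x - λ)^m (as polynomial functions on ℤ)
HasSpectrum : ∀ {n} → Matrix n → List (ℤ × ℕ) → Set
HasSpectrum L S = ∀ x → charPoly L x ≡ specPoly S x

laplacian : ∀ {n} → Matrix n → Matrix n
laplacian A i j = (δ i j * sumFin (A i)) - A i j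

module _ {c ℓ : Level} (G : Group c ℓ) where
  open Group G

  pow : ℕ → Carrier → Carrier
  pow zero    g = ε
  pow (suc k) g = g ∙ pow k g

  IsPosPower : Carrier → Carrier → Set ℓ
  IsPosPower u v = ∃ λ k → u ≈ pow (suc k) v

  PowerAdj : Carrier → Carrier → Set ℓ
  PowerAdj u v = ¬ (u ≈ v) × (IsPosPower u v ⊎ IsPosPower v u)

  IsEnumeration : ∀ {n} → (Fin n → Carrier) → Set (c Level.⊔ ℓ)
  IsEnumeration {n} e =
    (∀ i j → e i ≈ e j → i ≡ j) × (∀ g → ∃ λ i → e i ≈ g)

  IsPowerAdjMatrix : ∀ {n} → (Fin n → Carrier) → Matrix n → Set ℓ
  IsPowerAdjMatrix e A =
    ∀ i j → (A i j ≡ 1ℤ × PowerAdj (e i) (e j)) ⊎ (A i j ≡ 0ℤ × ¬ PowerAdj (e i) (e j))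

module Submission where

-- If G has an element g of order p², every element is a power of g, and any two elements of
-- order p are powers of each other since both lie in ⟨g^p⟩: the power graph is complete.
-- Otherwise every non-identity element has order p and generates one of the p + 1 subgroups
-- of order p, so the graph is a windmill: the identity joined to p + 1 disjoint cliques of
-- size p - 1. In both cases det(xI - L) is computed by repeatedly merging twins u, v:
-- subtracting row u from row v and adding column v to column u splits off a linear factor
-- and leaves a matrix of the same weighted shape with one vertex fewer.

module Sums where

  open import Defs using (sumFin)
  open import Data.Nat as ℕ using (ℕ; zero; suc; _≤_; z≤n; s≤s)
  import Data.Nat.Properties as ℕ
  open import Data.Fin using (Fin; zero; suc; punchIn; punchOut; _≟_)
  open import Data.Fin.Properties using (punchIn-injective; punchInᵢ≢i; punchIn-punchOut)
  open import Data.Integer using (ℤ; +_; _+_; _*_; 0ℤ; 1ℤ)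
  open import Data.Integer.Properties
    using (+-identityˡ; +-identityʳ; *-zeroˡ; *-zeroʳ; *-identityˡ; *-identityʳ; *-distribˡ-+; *-distribʳ-+; pos-+; +-injective)
  open import Data.Integer.Tactic.RingSolver using (solve-∀)
  open import Data.Product using (∃; _,_)
  open import Data.Empty using (⊥-elim)
  open import Relation.Nullary using (¬_; Dec; yes; no)
  open import Relation.Binary.PropositionalEquality

  sumFin-cong : ∀ {n} {f g : Fin n → ℤ} → (∀ i → f i ≡ g i) → sumFin f ≡ sumFin g
  sumFin-cong {zero}  f≗g = refl
  sumFin-cong {suc n} f≗g = cong₂ _+_ (f≗g zero) (sumFin-cong (λ i → f≗g (suc i)))

  sumFin-zero : ∀ {n} (f : Fin n → ℤ) → (∀ i → f i ≡ 0ℤ) → sumFin f ≡ 0ℤ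
  sumFin-zero {zero}  f f≗0 = refl
  sumFin-zero {suc n} f f≗0 = cong₂ _+_ (f≗0 zero) (sumFin-zero (λ i → f (suc i)) (λ i → f≗0 (suc i)))

  sumFin-+ : ∀ {n} (f g : Fin n → ℤ) → sumFin (λ i → f i + g i) ≡ sumFin f + sumFin g
  sumFin-+ {zero}  f g = refl
  sumFin-+ {suc n} f g =
    trans (cong (_+_ (f zero + g zero)) (sumFin-+ f′ g′)) (interchange (f zero) (g zero) (sumFin f′) (sumFin g′))
    where
    f′ g′ : Fin n → ℤ
    f′ i = f (suc i)
    g′ i = g (suc i)
    interchange : ∀ a b c d → (a + b) + (c + d) ≡ (a + c) + (b + d)
    interchange = solve-∀

  sumFin-*ˡ : ∀ {n} (c : ℤ) (f : Fin n → ℤ) → sumFin (λ i → c * f i) ≡ c * sumFin f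
  sumFin-*ˡ {zero}  c f = sym (*-zeroʳ c)
  sumFin-*ˡ {suc n} c f rewrite sumFin-*ˡ c (λ i → f (suc i)) = sym (*-distribˡ-+ c (f zero) _)

  sumFin-linear : ∀ {n} (a b : ℤ) (f g h : Fin n → ℤ) → (∀ i → h i ≡ a * f i + b * g i) →
                  sumFin h ≡ a * sumFin f + b * sumFin g
  sumFin-linear a b f g h h≗af+bg = begin
    sumFin h                                          ≡⟨ sumFin-cong h≗af+bg ⟩
    sumFin (λ i → a * f i + b * g i)                  ≡⟨ sumFin-+ (λ i → a * f i) (λ i → b * g i) ⟩
    sumFin (λ i → a * f i) + sumFin (λ i → b * g i)   ≡⟨ cong₂ _+_ (sumFin-*ˡ a f) (sumFin-*ˡ b g) ⟩
    a * sumFin f + b * sumFin g                       ∎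
    where open ≡-Reasoning

  sumFin-punchIn : ∀ {n} (f : Fin (suc n) → ℤ) (k : Fin (suc n)) →
                   sumFin f ≡ f k + sumFin (λ i → f (punchIn k i))
  sumFin-punchIn         f zero    = refl
  sumFin-punchIn {suc n} f (suc k) =
    trans (cong (_+_ (f zero)) (sumFin-punchIn f′ k)) (swap-front (f zero) (f′ k) (sumFin (λ i → f′ (punchIn k i))))
    where
    f′ : Fin (suc n) → ℤ
    f′ i = f (suc i)
    swap-front : ∀ a b c → a + (b + c) ≡ b + (a + c)
    swap-front = solve-∀

  sumFin-swap : ∀ {m n} (f : Fin m → Fin n → ℤ) →
                sumFin (λ i → sumFin (λ j → f i j)) ≡ sumFin (λ j → sumFin (λ i → f i j))
  sumFin-swap {zero} {n} f = sym (sumFin-zero {n} _ (λ _ → refl))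
  sumFin-swap {suc m} f rewrite sumFin-swap (λ i j → f (suc i) j) = sym (sumFin-+ (f zero) _)

  sumFin-single : ∀ {n} (f : Fin n → ℤ) (k : Fin n) → (∀ j → j ≢ k → f j ≡ 0ℤ) → sumFin f ≡ f k
  sumFin-single {suc n} f k f≗0 = begin
    sumFin f                              ≡⟨ sumFin-punchIn f k ⟩
    f k + sumFin (λ i → f (punchIn k i))  ≡⟨ cong (_+_ (f k)) (sumFin-zero _ (λ i → f≗0 _ (punchInᵢ≢i k i))) ⟩
    f k + 0ℤ                              ≡⟨ +-identityʳ (f k) ⟩
    f k                                   ∎
    where open ≡-Reasoning

  sumFin-pair : ∀ {n} (f : Fin n → ℤ) (a b : Fin n) → a ≢ b → (∀ j → j ≢ a → j ≢ b → f j ≡ 0ℤ) →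
                sumFin f ≡ f a + f b
  sumFin-pair {suc n} f a b a≢b f≗0 = begin
    sumFin f                                   ≡⟨ sumFin-punchIn f a ⟩
    f a + sumFin (λ i → f (punchIn a i))       ≡⟨ cong (_+_ (f a)) (sumFin-single _ (punchOut a≢b) rest≗0) ⟩
    f a + f (punchIn a (punchOut a≢b))         ≡⟨ cong (λ j → f a + f j) (punchIn-punchOut a≢b) ⟩
    f a + f b                                  ∎
    where
    open ≡-Reasoning
    rest≗0 : ∀ i → i ≢ punchOut a≢b → f (punchIn a i) ≡ 0ℤ
    rest≗0 i i≢b′ = f≗0 _ (punchInᵢ≢i a i)
      (λ eq → i≢b′ (punchIn-injective a i _ (trans eq (sym (punchIn-punchOut a≢b)))))

  sumFin-const : ∀ {n} (c : ℤ) (f : Fin n → ℤ) → (∀ i → f i ≡ c) → sumFin f ≡ + n * c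
  sumFin-const {zero}  c f f≗c = sym (*-zeroˡ c)
  sumFin-const {suc n} c f f≗c = begin
    f zero + sumFin (λ i → f (suc i))  ≡⟨ cong₂ _+_ (f≗c zero) (sumFin-const c _ (λ i → f≗c (suc i))) ⟩
    c + + n * c                        ≡⟨ cong (_+ + n * c) (sym (*-identityˡ c)) ⟩
    1ℤ * c + + n * c                   ≡⟨ sym (*-distribʳ-+ c 1ℤ (+ n)) ⟩
    (1ℤ + + n) * c                     ≡⟨ cong (_* c) (sym (pos-+ 1 n)) ⟩
    + suc n * c                        ∎
    where open ≡-Reasoning

  indicator : ∀ {p} {P : Set p} → Dec P → ℤ
  indicator (yes _) = 1ℤ
  indicator (no _)  = 0ℤ

  indicator-yes : ∀ {p} {P : Set p} (P? : Dec P) → P → indicator P? ≡ 1ℤ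
  indicator-yes (yes _) _  = refl
  indicator-yes (no ¬p) p  = ⊥-elim (¬p p)

  indicator-no : ∀ {p} {P : Set p} (P? : Dec P) → ¬ P → indicator P? ≡ 0ℤ
  indicator-no (yes p) ¬p = ⊥-elim (¬p p)
  indicator-no (no _)  _  = refl

  indicator-cong : ∀ {p q} {P : Set p} {Q : Set q} (P? : Dec P) (Q? : Dec Q) →
                   (P → Q) → (Q → P) → indicator P? ≡ indicator Q?
  indicator-cong (yes p) Q? P→Q Q→P = sym (indicator-yes Q? (P→Q p))
  indicator-cong (no ¬p) Q? P→Q Q→P = sym (indicator-no Q? (λ q → ¬p (Q→P q)))

  count : ∀ {n p} {Q : Fin n → Set p} → (∀ j → Dec (Q j)) → ℕ
  count {zero}  Q? = 0
  count {suc n} Q? with Q? zero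
  ... | yes _ = suc (count (λ j → Q? (suc j)))
  ... | no _  = count (λ j → Q? (suc j))

  count≤ : ∀ {n p} {Q : Fin n → Set p} (Q? : ∀ j → Dec (Q j)) → count Q? ≤ n
  count≤ {zero}  Q? = z≤n
  count≤ {suc n} Q? with Q? zero
  ... | yes _ = s≤s (count≤ (λ j → Q? (suc j)))
  ... | no _  = ℕ.m≤n⇒m≤1+n (count≤ (λ j → Q? (suc j)))

  sumFin-indicator : ∀ {n p} {Q : Fin n → Set p} (Q? : ∀ j → Dec (Q j)) →
                     sumFin (λ j → indicator (Q? j)) ≡ + count Q?
  sumFin-indicator {zero}  Q? = refl
  sumFin-indicator {suc n} Q? with Q? zero
  ... | yes _ = trans (cong (_+_ 1ℤ) (sumFin-indicator (λ j → Q? (suc j)))) (sym (pos-+ 1 _))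
  ... | no _  = trans (cong (_+_ 0ℤ) (sumFin-indicator (λ j → Q? (suc j)))) (+-identityˡ _)

  sumFin-indicator-≟ : ∀ {n} (k : Fin n) → sumFin (λ j → indicator (k ≟ j)) ≡ 1ℤ
  sumFin-indicator-≟ k =
    trans (sumFin-single _ k (λ j j≢k → indicator-no (k ≟ j) (λ k≡j → j≢k (sym k≡j))))
          (indicator-yes (k ≟ k) refl)

  -- Double counting the pairs (a, j) with h a ≡ j.
  sumFin-indicator-image : ∀ {k n p} {Q : Fin n → Set p} (Q? : ∀ j → Dec (Q j)) (h : Fin k → Fin n) →
    (∀ a b → h a ≡ h b → a ≡ b) → (∀ a → Q (h a)) → (∀ j → Q j → ∃ λ a → h a ≡ j) →
    sumFin (λ j → indicator (Q? j)) ≡ + k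
  sumFin-indicator-image {k} {Q = Q} Q? h h-injective h∈Q Q⊆h = begin
    sumFin (λ j → indicator (Q? j))                        ≡⟨ sumFin-cong fibre-size ⟩
    sumFin (λ j → sumFin (λ a → indicator (h a ≟ j)))      ≡⟨ sumFin-swap (λ j a → indicator (h a ≟ j)) ⟩
    sumFin (λ a → sumFin (λ j → indicator (h a ≟ j)))      ≡⟨ sumFin-cong (λ a → sumFin-indicator-≟ (h a)) ⟩
    sumFin {k} (λ _ → 1ℤ)                                  ≡⟨ sumFin-const {k} 1ℤ _ (λ _ → refl) ⟩
    + k * 1ℤ                                               ≡⟨ *-identityʳ (+ k) ⟩
    + k                                                    ∎
    where
    open ≡-Reasoning
    fibre-size : ∀ j → indicator (Q? j) ≡ sumFin (λ a → indicator (h a ≟ j))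
    fibre-size j with Q? j
    ... | no ¬q = sym (sumFin-zero _ (λ a → indicator-no (h a ≟ j) (λ ha≡j → ¬q (subst Q ha≡j (h∈Q a)))))
    ... | yes q with Q⊆h j q
    ...   | a₀ , ha₀≡j = sym (trans
            (sumFin-single _ a₀ (λ a a≢a₀ → indicator-no (h a ≟ j)
               (λ ha≡j → a≢a₀ (h-injective a a₀ (trans ha≡j (sym ha₀≡j))))))
            (indicator-yes (h a₀ ≟ j) ha₀≡j))

  sumFin-indicator-full : ∀ {n p} {Q : Fin n → Set p} (Q? : ∀ j → Dec (Q j)) →
                          sumFin (λ j → indicator (Q? j)) ≡ + n → ∀ j → Q j
  sumFin-indicator-full {suc n} Q? total j with Q? j in eq
  ... | yes q = q
  ... | no ¬q = ⊥-elim (ℕ.<-irrefl refl (ℕ.≤-trans (s≤s (count≤ others?)) (ℕ.≤-reflexive n+1≡count)))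
    where
    others? = λ i → Q? (punchIn j i)
    n+1≡count : suc n ≡ count others?
    n+1≡count = +-injective (begin
      + suc n                                          ≡⟨ sym total ⟩
      sumFin (λ i → indicator (Q? i))                  ≡⟨ sumFin-punchIn (λ i → indicator (Q? i)) j ⟩
      indicator (Q? j) + sumFin (λ i → indicator (others? i))
                                                       ≡⟨ cong (λ d → indicator d + sumFin (λ i → indicator (others? i))) eq ⟩
      0ℤ + sumFin (λ i → indicator (others? i))        ≡⟨ +-identityˡ _ ⟩
      sumFin (λ i → indicator (others? i))             ≡⟨ sumFin-indicator others? ⟩
      + count others?                                  ∎)
      where open ≡-Reasoning

  sumFin-all-but-one : ∀ {n} (f : Fin (suc n) → ℤ) (k : Fin (suc n)) → f k ≡ 0ℤ → (∀ j → j ≢ k → f j ≡ 1ℤ) →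
                       sumFin f ≡ + n
  sumFin-all-but-one {n} f k fₖ≡0 f≡1 = begin
    sumFin f                                ≡⟨ sumFin-punchIn f k ⟩
    f k + sumFin (λ i → f (punchIn k i))    ≡⟨ cong₂ _+_ fₖ≡0 (sumFin-const 1ℤ _ (λ i → f≡1 _ (punchInᵢ≢i k i))) ⟩
    0ℤ + + n * 1ℤ                           ≡⟨ +-identityˡ _ ⟩
    + n * 1ℤ                                ≡⟨ *-identityʳ (+ n) ⟩
    + n                                     ∎
    where open ≡-Reasoning

module Determinant where

  open import Defs using (Matrix; sumFin; δ; det)
  open Sums
  open import Data.Nat as ℕ using (ℕ; zero; suc)
  open import Data.Fin using (Fin; zero; suc; toℕ; punchIn; punchOut; _≟_)
  open import Data.Fin.Properties using (punchIn-injective; punchInᵢ≢i; punchIn-punchOut; suc-injective)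
  open import Data.Integer using (ℤ; -_; _+_; _-_; _*_; _^_; 0ℤ; 1ℤ; -1ℤ)
  open import Data.Integer.Properties using (^-distribˡ-+-*; +-identityˡ; *-zeroʳ; *-identityˡ; *-identityʳ)
  open import Data.Integer.Tactic.RingSolver using (solve-∀)
  open import Data.Product using (∃; _,_; _×_; proj₁; proj₂)
  open import Data.Empty using (⊥-elim)
  open import Relation.Nullary using (yes; no)
  open import Relation.Binary.PropositionalEquality

  sgn : ℕ → ℤ
  sgn k = -1ℤ ^ k

  sgn-+ : ∀ k l → sgn (k ℕ.+ l) ≡ sgn k * sgn l
  sgn-+ = ^-distribˡ-+-* -1ℤ

  sgn-double : ∀ k → sgn (k ℕ.+ k) ≡ 1ℤ
  sgn-double k = trans (sgn-+ k k) (square k)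
    where
    square : ∀ k → sgn k * sgn k ≡ 1ℤ
    square zero    = refl
    square (suc k) = trans (negate-both (sgn k)) (square k)
      where
      negate-both : ∀ s → (-1ℤ * s) * (-1ℤ * s) ≡ s * s
      negate-both = solve-∀

  δ-diag : ∀ {n} (k : Fin n) → δ k k ≡ 1ℤ
  δ-diag zero    = refl
  δ-diag (suc k) = δ-diag k

  δ-off : ∀ {n} (k c : Fin n) → k ≢ c → δ k c ≡ 0ℤ
  δ-off zero    zero    k≢c = ⊥-elim (k≢c refl)
  δ-off zero    (suc c) _   = refl
  δ-off (suc k) zero    _   = refl
  δ-off (suc k) (suc c) k≢c = δ-off k c (λ eq → k≢c (cong suc eq))

  minor : ∀ {n} → Matrix (suc n) → Fin (suc n) → Fin (suc n) → Matrix n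
  minor M i k r c = M (punchIn i r) (punchIn k c)

  det-cong : ∀ {n} {M N : Matrix n} → (∀ i j → M i j ≡ N i j) → det M ≡ det N
  det-cong {zero}  M≗N = refl
  det-cong {suc n} M≗N = sumFin-cong λ j →
    cong₂ (λ m d → sgn (toℕ j) * (m * d)) (M≗N zero j) (det-cong (λ r c → M≗N (suc r) (punchIn j c)))

  expansion-term : ∀ {n} → Matrix (suc n) → Fin (suc n) → ℤ
  expansion-term M j = sgn (toℕ j) * (M zero j * det (minor M zero j))

  det-row-linear : ∀ {n} (i : Fin n) (M N P : Matrix n) (a b : ℤ) →
    (∀ r c → r ≢ i → N r c ≡ M r c) → (∀ r c → r ≢ i → P r c ≡ M r c) →
    (∀ c → P i c ≡ a * M i c + b * N i c) → det P ≡ a * det M + b * det N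
  det-row-linear {suc n} zero M N P a b N≗M P≗M Pᵢ = sumFin-linear a b _ _ _ termwise
    where
    termwise : ∀ j → expansion-term P j ≡ a * expansion-term M j + b * expansion-term N j
    termwise j = begin
      s * (P zero j * det (minor P zero j))               ≡⟨ cong₂ (λ x d → s * (x * d)) (Pᵢ j) minor-P ⟩
      s * ((a * M zero j + b * N zero j) * D)             ≡⟨ distrib a b s (M zero j) (N zero j) D ⟩
      a * (s * (M zero j * D)) + b * (s * (N zero j * D)) ≡⟨ cong (λ d → a * (s * (M zero j * D)) + b * (s * (N zero j * d))) minor-N ⟩
      a * expansion-term M j + b * expansion-term N j     ∎
      where
      open ≡-Reasoning
      s = sgn (toℕ j)
      D = det (minor M zero j)
      minor-P : det (minor P zero j) ≡ D
      minor-P = det-cong (λ r c → P≗M (suc r) _ λ ())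
      minor-N : D ≡ det (minor N zero j)
      minor-N = det-cong (λ r c → sym (N≗M (suc r) _ λ ()))
      distrib : ∀ a b s m n d → s * ((a * m + b * n) * d) ≡ a * (s * (m * d)) + b * (s * (n * d))
      distrib = solve-∀
  det-row-linear {suc n} (suc i) M N P a b N≗M P≗M Pᵢ = sumFin-linear a b _ _ _ termwise
    where
    termwise : ∀ j → expansion-term P j ≡ a * expansion-term M j + b * expansion-term N j
    termwise j = begin
      s * (P zero j * det (minor P zero j))               ≡⟨ cong₂ (λ x d → s * (x * d)) (P≗M zero j λ ()) minor-P ⟩
      s * (M zero j * (a * D + b * D′))                   ≡⟨ distrib a b s (M zero j) D D′ ⟩
      a * (s * (M zero j * D)) + b * (s * (M zero j * D′)) ≡⟨ cong (λ x → a * (s * (M zero j * D)) + b * (s * (x * D′))) (sym (N≗M zero j λ ())) ⟩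
      a * expansion-term M j + b * expansion-term N j     ∎
      where
      open ≡-Reasoning
      s = sgn (toℕ j)
      D = det (minor M zero j)
      D′ = det (minor N zero j)
      minor-P : det (minor P zero j) ≡ a * D + b * D′
      minor-P = det-row-linear i (minor M zero j) (minor N zero j) (minor P zero j) a b
        (λ r c r≢i → N≗M (suc r) _ (λ eq → r≢i (suc-injective eq)))
        (λ r c r≢i → P≗M (suc r) _ (λ eq → r≢i (suc-injective eq)))
        (λ c → Pᵢ _)
      distrib : ∀ a b s m d e → s * (m * (a * d + b * e)) ≡ a * (s * (m * d)) + b * (s * (m * e))
      distrib = solve-∀

  det-zero-row : ∀ {n} (M : Matrix n) (i : Fin n) → (∀ c → M i c ≡ 0ℤ) → det M ≡ 0ℤ
  det-zero-row M i Mᵢ≗0 =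
    trans (det-row-linear i M M M 0ℤ 0ℤ (λ _ _ _ → refl) (λ _ _ _ → refl) (λ c → trans (Mᵢ≗0 c) (zero-combination (M i c))))
          (sym (zero-combination (det M)))
    where
    zero-combination : ∀ x → 0ℤ ≡ 0ℤ * x + 0ℤ * x
    zero-combination = solve-∀

  punchIn-punchIn-comm : ∀ {n} (k : Fin (suc (suc n))) (j : Fin (suc n)) (j′≢k : punchIn k j ≢ k) (c : Fin n) →
    punchIn (punchIn k j) (punchIn (punchOut j′≢k) c) ≡ punchIn k (punchIn j c)
  punchIn-punchIn-comm zero    j       _     c       = refl
  punchIn-punchIn-comm (suc k) zero    _     c       = refl
  punchIn-punchIn-comm {suc n} (suc k) (suc j) _ zero = refl
  punchIn-punchIn-comm {suc n} (suc k) (suc j) j′≢k (suc c) =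
    cong suc (punchIn-punchIn-comm k j (λ eq → j′≢k (cong suc eq)) c)

  sgn-punchIn-punchOut : ∀ {n} (k : Fin (suc (suc n))) (j : Fin (suc n)) (j′≢k : punchIn k j ≢ k) →
    sgn (toℕ (punchIn k j)) * sgn (toℕ (punchOut j′≢k)) ≡ - (sgn (toℕ k) * sgn (toℕ j))
  sgn-punchIn-punchOut zero    j       _ = base (sgn (toℕ j))
    where
    base : ∀ s → (-1ℤ * s) * 1ℤ ≡ - (1ℤ * s)
    base = solve-∀
  sgn-punchIn-punchOut (suc k) zero    _ = base (sgn (toℕ k))
    where
    base : ∀ s → 1ℤ * s ≡ - ((-1ℤ * s) * 1ℤ)
    base = solve-∀
  sgn-punchIn-punchOut {suc n} (suc k) (suc j) j′≢k =
    step (sgn (toℕ (punchIn k j))) (sgn (toℕ (punchOut j″≢k))) (sgn (toℕ k)) (sgn (toℕ j))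
         (sgn-punchIn-punchOut k j j″≢k)
    where
    j″≢k : punchIn k j ≢ k
    j″≢k eq = j′≢k (cong suc eq)
    step : ∀ a b c d → a * b ≡ - (c * d) → (-1ℤ * a) * (-1ℤ * b) ≡ - ((-1ℤ * c) * (-1ℤ * d))
    step a b c d eq = trans (cancel a b) (trans eq (cancel′ c d))
      where
      cancel : ∀ a b → (-1ℤ * a) * (-1ℤ * b) ≡ a * b
      cancel = solve-∀
      cancel′ : ∀ c d → - (c * d) ≡ - ((-1ℤ * c) * (-1ℤ * d))
      cancel′ = solve-∀

  det-sparse-row : ∀ {n} (M : Matrix (suc n)) (i k : Fin (suc n)) → (∀ j → j ≢ k → M i j ≡ 0ℤ) →
    det M ≡ sgn (toℕ i ℕ.+ toℕ k) * (M i k * det (minor M i k))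
  det-sparse-row M zero k Mᵢ≗0 =
    sumFin-single _ k λ j j≢k →
      trans (cong (λ m → sgn (toℕ j) * (m * det (minor M zero j))) (Mᵢ≗0 j j≢k))
            (vanish (sgn (toℕ j)) (det (minor M zero j)))
    where
    vanish : ∀ s d → s * (0ℤ * d) ≡ 0ℤ
    vanish = solve-∀
  -- Expanding along row 0, the term of column k vanishes (its minor has a zero row), and the
  -- minors of the other terms are expanded along their sparse row i by induction.
  det-sparse-row {suc n} M (suc i) k Mᵢ≗0 = begin
    det M                                    ≡⟨ sumFin-punchIn T k ⟩
    T k + sumFin (λ j → T (punchIn k j))     ≡⟨ cong₂ _+_ Tₖ≡0 (sumFin-cong expand) ⟩
    0ℤ + sumFin (λ j → C * U j)              ≡⟨ +-identityˡ (sumFin (λ j → C * U j)) ⟩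
    sumFin (λ j → C * U j)                   ≡⟨ sumFin-*ˡ C U ⟩
    C * det (minor M (suc i) k)              ≡⟨ regroup (sgn (toℕ i)) (sgn (toℕ k)) (M (suc i) k) (det (minor M (suc i) k)) ⟩
    (-1ℤ * (sgn (toℕ i) * sgn (toℕ k))) * (M (suc i) k * det (minor M (suc i) k))
                                             ≡⟨ cong (λ s → (-1ℤ * s) * (M (suc i) k * det (minor M (suc i) k))) (sym (sgn-+ (toℕ i) (toℕ k))) ⟩
    sgn (toℕ (suc i) ℕ.+ toℕ k) * (M (suc i) k * det (minor M (suc i) k)) ∎
    where
    open ≡-Reasoning
    T : Fin (suc (suc n)) → ℤ
    T = expansion-term M
    C : ℤ
    C = - (sgn (toℕ i) * sgn (toℕ k)) * M (suc i) k
    U : Fin (suc n) → ℤ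
    U j = sgn (toℕ j) * (M zero (punchIn k j) * det (minor (minor M (suc i) k) zero j))
    regroup : ∀ a b m x → (- (a * b)) * m * x ≡ (-1ℤ * (a * b)) * (m * x)
    regroup = solve-∀
    Tₖ≡0 : T k ≡ 0ℤ
    Tₖ≡0 = trans (cong (λ d → sgn (toℕ k) * (M zero k * d))
                       (det-zero-row (minor M zero k) i (λ c → Mᵢ≗0 _ (punchInᵢ≢i k c))))
                 (vanish (sgn (toℕ k)) (M zero k))
      where
      vanish : ∀ s m → s * (m * 0ℤ) ≡ 0ℤ
      vanish = solve-∀
    expand : ∀ j → T (punchIn k j) ≡ C * U j
    expand j = begin
      sgn (toℕ j′) * (M zero j′ * det (minor M zero j′))
        ≡⟨ cong (λ d → sgn (toℕ j′) * (M zero j′ * d)) inner ⟩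
      sgn (toℕ j′) * (M zero j′ * ((sgn (toℕ i) * sgn (toℕ j″)) * (M (suc i) k * D)))
        ≡⟨ reorder (sgn (toℕ j′)) (M zero j′) (sgn (toℕ i)) (sgn (toℕ j″)) (M (suc i) k) D
                   (sgn (toℕ k)) (sgn (toℕ j)) (sgn-punchIn-punchOut k j j′≢k) ⟩
      C * U j ∎
      where
      j′ : Fin (suc (suc n))
      j′ = punchIn k j
      j′≢k : j′ ≢ k
      j′≢k = punchInᵢ≢i k j
      j″ : Fin (suc n)
      j″ = punchOut j′≢k
      D = det (minor (minor M (suc i) k) zero j)
      inner : det (minor M zero j′) ≡ (sgn (toℕ i) * sgn (toℕ j″)) * (M (suc i) k * D)
      inner = begin
        det (minor M zero j′)
          ≡⟨ det-sparse-row (minor M zero j′) i j″ (λ c c≢j″ → Mᵢ≗0 _ λ eq →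
               c≢j″ (punchIn-injective j′ c j″ (trans eq (sym (punchIn-punchOut j′≢k))))) ⟩
        sgn (toℕ i ℕ.+ toℕ j″) * (M (suc i) (punchIn j′ j″) * det (minor (minor M zero j′) i j″))
          ≡⟨ cong₂ _*_ (sgn-+ (toℕ i) (toℕ j″))
                   (cong₂ _*_ (cong (M (suc i)) (punchIn-punchOut j′≢k))
                              (det-cong (λ r c → cong (M (suc (punchIn i r))) (punchIn-punchIn-comm k j j′≢k c)))) ⟩
        (sgn (toℕ i) * sgn (toℕ j″)) * (M (suc i) k * D) ∎
      reorder : ∀ sj m si sk′ x d sk sj′ → sj * sk′ ≡ - (sk * sj′) →
                sj * (m * ((si * sk′) * (x * d))) ≡ (- (si * sk) * x) * (sj′ * (m * d))
      reorder sj m si sk′ x d sk sj′ eq =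
        trans (gather sj m si sk′ x d) (trans (cong (λ z → z * si * m * x * d) eq) (scatter m si x d sk sj′))
        where
        gather : ∀ sj m si sk′ x d → sj * (m * ((si * sk′) * (x * d))) ≡ (sj * sk′) * si * m * x * d
        gather = solve-∀
        scatter : ∀ m si x d sk sj′ → (- (sk * sj′)) * si * m * x * d ≡ (- (si * sk) * x) * (sj′ * (m * d))
        scatter = solve-∀

  setRow : ∀ {n} → Matrix n → Fin n → (Fin n → ℤ) → Matrix n
  setRow M i v r c with r ≟ i
  ... | yes _ = v c
  ... | no _  = M r c

  setRow-same : ∀ {n} (M : Matrix n) i v c → setRow M i v i c ≡ v c
  setRow-same M i v c with i ≟ i
  ... | yes _   = refl
  ... | no i≢i  = ⊥-elim (i≢i refl)

  setRow-other : ∀ {n} (M : Matrix n) i v r c → r ≢ i → setRow M i v r c ≡ M r c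
  setRow-other M i v r c r≢i with r ≟ i
  ... | yes r≡i = ⊥-elim (r≢i r≡i)
  ... | no _    = refl

  det-row-sum : ∀ {K n} (i : Fin n) (M : Matrix n) (v : Fin K → Fin n → ℤ) →
    (∀ c → M i c ≡ sumFin (λ k → v k c)) → det M ≡ sumFin (λ k → det (setRow M i (v k)))
  det-row-sum {zero}  i M v Mᵢ≡Σv = det-zero-row M i Mᵢ≡Σv
  det-row-sum {suc K} i M v Mᵢ≡Σv = begin
    det M                             ≡⟨ det-row-linear i Head Tail M 1ℤ 1ℤ
                                           (λ r c r≢i → trans (setRow-other M i _ r c r≢i) (sym (setRow-other M i _ r c r≢i)))
                                           (λ r c r≢i → sym (setRow-other M i _ r c r≢i))
                                           (λ c → trans (Mᵢ≡Σv c) (split c)) ⟩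
    1ℤ * det Head + 1ℤ * det Tail     ≡⟨ unit (det Head) (det Tail) ⟩
    det Head + det Tail               ≡⟨ cong (_+_ (det Head)) (det-row-sum i Tail (λ k → v (suc k)) (setRow-same M i _)) ⟩
    det Head + sumFin (λ k → det (setRow Tail i (v (suc k))))
                                      ≡⟨ cong (_+_ (det Head)) (sumFin-cong (λ k → det-cong (setRow-twice (v (suc k))))) ⟩
    sumFin (λ k → det (setRow M i (v k))) ∎
    where
    open ≡-Reasoning
    rest : Fin _ → ℤ
    rest c = sumFin (λ k → v (suc k) c)
    Head = setRow M i (v zero)
    Tail = setRow M i rest
    unit : ∀ a b → 1ℤ * a + 1ℤ * b ≡ a + b
    unit = solve-∀
    split : ∀ c → v zero c + rest c ≡ 1ℤ * Head i c + 1ℤ * Tail i c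
    split c = trans (sym (unit (v zero c) (rest c)))
                    (sym (cong₂ (λ a b → 1ℤ * a + 1ℤ * b) (setRow-same M i _ c) (setRow-same M i _ c)))
    setRow-twice : ∀ w r c → setRow Tail i w r c ≡ setRow M i w r c
    setRow-twice w r c with r ≟ i
    ... | yes _   = refl
    ... | no r≢i  = setRow-other M i rest r c r≢i

  det-row-expansion : ∀ {n} (M : Matrix (suc n)) (i : Fin (suc n)) →
    det M ≡ sumFin (λ k → sgn (toℕ i ℕ.+ toℕ k) * (M i k * det (minor M i k)))
  det-row-expansion M i =
    trans (det-row-sum i M unitRow (λ c → sym (trans (sumFin-single _ c (λ k k≢c → entry-off k c k≢c)) (entry-on c))))
          (sumFin-cong λ k → begin
            det (setRow M i (unitRow k))
              ≡⟨ det-sparse-row (setRow M i (unitRow k)) i k (λ j j≢k → trans (setRow-same M i (unitRow k) j) (entry-off k j (λ k≡j → j≢k (sym k≡j)))) ⟩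
            sgn (toℕ i ℕ.+ toℕ k) * (setRow M i (unitRow k) i k * det (minor (setRow M i (unitRow k)) i k))
              ≡⟨ cong₂ (λ m d → sgn (toℕ i ℕ.+ toℕ k) * (m * d))
                       (trans (setRow-same M i (unitRow k) k) (entry-on k))
                       (det-cong (λ r c → setRow-other M i (unitRow k) (punchIn i r) (punchIn k c) (punchInᵢ≢i i r))) ⟩
            sgn (toℕ i ℕ.+ toℕ k) * (M i k * det (minor M i k)) ∎)
    where
    open ≡-Reasoning
    unitRow : Fin _ → Fin _ → ℤ
    unitRow k c = M i k * δ k c
    entry-on : ∀ k → unitRow k k ≡ M i k
    entry-on k = trans (cong (M i k *_) (δ-diag k)) (*-identityʳ (M i k))
    entry-off : ∀ k c → k ≢ c → unitRow k c ≡ 0ℤ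
    entry-off k c k≢c = trans (cong (M i k *_) (δ-off k c k≢c)) (*-zeroʳ (M i k))

  det₂ : (M : Matrix 2) → det M ≡ M zero zero * M (suc zero) (suc zero) - M zero (suc zero) * M (suc zero) zero
  det₂ M = expand (M zero zero) (M zero (suc zero)) (M (suc zero) zero) (M (suc zero) (suc zero))
    where
    expand : ∀ a b c d → 1ℤ * (a * (1ℤ * (d * 1ℤ) + 0ℤ)) + ((-1ℤ * 1ℤ) * (b * (1ℤ * (c * 1ℤ) + 0ℤ)) + 0ℤ)
                         ≡ a * d - b * c
    expand = solve-∀

  avoid-two : ∀ {n} (a b : Fin (suc (suc (suc n)))) → ∃ λ r → r ≢ a × r ≢ b
  avoid-two zero           zero           = suc zero , (λ ()) , (λ ())
  avoid-two zero           (suc zero)     = suc (suc zero) , (λ ()) , (λ ())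
  avoid-two zero           (suc (suc _))  = suc zero , (λ ()) , (λ ())
  avoid-two (suc zero)     zero           = suc (suc zero) , (λ ()) , (λ ())
  avoid-two (suc zero)     (suc zero)     = zero , (λ ()) , (λ ())
  avoid-two (suc zero)     (suc (suc _))  = zero , (λ ()) , (λ ())
  avoid-two (suc (suc _))  zero           = suc zero , (λ ()) , (λ ())
  avoid-two (suc (suc _))  (suc zero)     = zero , (λ ()) , (λ ())
  avoid-two (suc (suc _))  (suc (suc _))  = zero , (λ ()) , (λ ())

  -- For n ≥ 3 expand along a third row: every minor still has two equal rows.
  det-equal-rows : ∀ {n} (M : Matrix n) (a b : Fin n) → a ≢ b → (∀ c → M a c ≡ M b c) → det M ≡ 0ℤ
  det-equal-rows {suc zero} M zero zero a≢b _ = ⊥-elim (a≢b refl)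
  det-equal-rows {suc (suc zero)} M zero zero a≢b _ = ⊥-elim (a≢b refl)
  det-equal-rows {suc (suc zero)} M (suc zero) (suc zero) a≢b _ = ⊥-elim (a≢b refl)
  det-equal-rows {suc (suc zero)} M zero (suc zero) _ M₀≡M₁ =
    trans (det₂ M) (trans (cong₂ (λ x y → x * M (suc zero) (suc zero) - y * M (suc zero) zero) (M₀≡M₁ zero) (M₀≡M₁ (suc zero)))
                          (cancel (M (suc zero) zero) (M (suc zero) (suc zero))))
    where
    cancel : ∀ a b → a * b - b * a ≡ 0ℤ
    cancel = solve-∀
  det-equal-rows {suc (suc zero)} M (suc zero) zero _ M₁≡M₀ =
    trans (det₂ M) (trans (cong₂ (λ x y → M zero zero * x - M zero (suc zero) * y) (M₁≡M₀ (suc zero)) (M₁≡M₀ zero))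
                          (cancel (M zero zero) (M zero (suc zero))))
    where
    cancel : ∀ a b → a * b - b * a ≡ 0ℤ
    cancel = solve-∀
  det-equal-rows {suc (suc (suc n))} M a b a≢b Mₐ≡M_b =
    trans (det-row-expansion M r) (sumFin-zero _ λ k →
      trans (cong (λ d → sgn (toℕ r ℕ.+ toℕ k) * (M r k * d))
                  (det-equal-rows (minor M r k) (punchOut r≢a) (punchOut r≢b)
                     (λ eq → a≢b (trans (sym (punchIn-punchOut r≢a))
                                        (trans (cong (punchIn r) eq) (punchIn-punchOut r≢b))))
                     (λ c → trans (cong (λ z → M z (punchIn k c)) (punchIn-punchOut r≢a))
                              (trans (Mₐ≡M_b (punchIn k c))
                                     (cong (λ z → M z (punchIn k c)) (sym (punchIn-punchOut r≢b)))))))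
            (vanish (sgn (toℕ r ℕ.+ toℕ k)) (M r k)))
    where
    r : Fin (suc (suc (suc n)))
    r = proj₁ (avoid-two a b)
    r≢a : r ≢ a
    r≢a = proj₁ (proj₂ (avoid-two a b))
    r≢b : r ≢ b
    r≢b = proj₂ (proj₂ (avoid-two a b))
    vanish : ∀ s m → s * (m * 0ℤ) ≡ 0ℤ
    vanish = solve-∀

  det-add-row-multiple : ∀ {n} (M : Matrix n) (i l : Fin n) (c : ℤ) → i ≢ l →
    det (setRow M i (λ s → M i s + c * M l s)) ≡ det M
  det-add-row-multiple M i l c i≢l = begin
    det (setRow M i (λ s → M i s + c * M l s))  ≡⟨ det-row-linear i M (setRow M i (M l)) _ 1ℤ c
                                                     (λ r s r≢i → setRow-other M i _ r s r≢i)
                                                     (λ r s r≢i → setRow-other M i _ r s r≢i)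
                                                     new-row ⟩
    1ℤ * det M + c * det (setRow M i (M l))     ≡⟨ cong (λ d → 1ℤ * det M + c * d)
                                                     (det-equal-rows (setRow M i (M l)) i l i≢l
                                                       (λ s → trans (setRow-same M i _ s) (sym (setRow-other M i _ l s (λ l≡i → i≢l (sym l≡i)))))) ⟩
    1ℤ * det M + c * 0ℤ                         ≡⟨ drop (det M) c ⟩
    det M                                       ∎
    where
    open ≡-Reasoning
    unit : ∀ a b → a + b ≡ 1ℤ * a + b
    unit = solve-∀
    new-row : ∀ s → setRow M i (λ s → M i s + c * M l s) i s ≡ 1ℤ * M i s + c * setRow M i (M l) i s
    new-row s = trans (setRow-same M i _ s)
                      (trans (cong (λ m → M i s + c * m) (sym (setRow-same M i (M l) s)))
                             (unit (M i s) (c * setRow M i (M l) i s)))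
    drop : ∀ d c → 1ℤ * d + c * 0ℤ ≡ d
    drop = solve-∀

  det-column-expansion : ∀ {n} (M : Matrix (suc n)) →
    det M ≡ sumFin (λ i → sgn (toℕ i) * (M i zero * det (minor M i zero)))
  det-column-expansion {zero}  M = refl
  det-column-expansion {suc n} M = cong (_+_ (sgn 0 * (M zero zero * det (minor M zero zero)))) (begin
    sumFin (λ j → sgn (toℕ (suc j)) * (M zero (suc j) * det (minor M zero (suc j))))
      ≡⟨ sumFin-cong (λ j → cong (λ d → sgn (toℕ (suc j)) * (M zero (suc j) * d))
                                  (det-column-expansion (minor M zero (suc j)))) ⟩
    sumFin (λ j → sgn (toℕ (suc j)) * (M zero (suc j) * sumFin (λ i → sgn (toℕ i) * (M (suc i) zero * D i j))))
      ≡⟨ sumFin-cong (λ j → pull-in (sgn (toℕ (suc j))) (M zero (suc j)) (λ i → sgn (toℕ i) * (M (suc i) zero * D i j))) ⟩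
    sumFin (λ j → sumFin (λ i → sgn (toℕ (suc j)) * (M zero (suc j) * (sgn (toℕ i) * (M (suc i) zero * D i j)))))
      ≡⟨ sumFin-swap (λ j i → sgn (toℕ (suc j)) * (M zero (suc j) * (sgn (toℕ i) * (M (suc i) zero * D i j)))) ⟩
    sumFin (λ i → sumFin (λ j → sgn (toℕ (suc j)) * (M zero (suc j) * (sgn (toℕ i) * (M (suc i) zero * D i j)))))
      ≡⟨ sumFin-cong (λ i → sumFin-cong (λ j →
           exchange (sgn (toℕ j)) (M zero (suc j)) (sgn (toℕ i)) (M (suc i) zero) (D i j))) ⟩
    sumFin (λ i → sumFin (λ j → sgn (toℕ (suc i)) * (M (suc i) zero * (sgn (toℕ j) * (M zero (suc j) * D i j)))))
      ≡⟨ sumFin-cong (λ i → sym (pull-in (sgn (toℕ (suc i))) (M (suc i) zero) (λ j → sgn (toℕ j) * (M zero (suc j) * D i j)))) ⟩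
    sumFin (λ i → sgn (toℕ (suc i)) * (M (suc i) zero * det (minor M (suc i) zero))) ∎)
    where
    open ≡-Reasoning
    D : Fin (suc n) → Fin (suc n) → ℤ
    D i j = det (minor (minor M zero zero) i j)
    pull-in : ∀ s m (f : Fin (suc n) → ℤ) → s * (m * sumFin f) ≡ sumFin (λ i → s * (m * f i))
    pull-in s m f = sym (trans (sumFin-*ˡ s (λ i → m * f i)) (cong (s *_) (sumFin-*ˡ m f)))
    exchange : ∀ sj m si m′ d → (-1ℤ * sj) * (m * (si * (m′ * d))) ≡ (-1ℤ * si) * (m′ * (sj * (m * d)))
    exchange = solve-∀

  transpose : ∀ {n} → Matrix n → Matrix n
  transpose M i j = M j i

  det-transpose : ∀ {n} (M : Matrix n) → det (transpose M) ≡ det M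
  det-transpose {zero}  M = refl
  det-transpose {suc n} M =
    trans (sumFin-cong (λ i → cong (λ d → sgn (toℕ i) * (M i zero * d)) (det-transpose (minor M i zero))))
          (sym (det-column-expansion M))

  setColumn : ∀ {n} → Matrix n → Fin n → (Fin n → ℤ) → Matrix n
  setColumn M j v = transpose (setRow (transpose M) j v)

  det-add-column-multiple : ∀ {n} (M : Matrix n) (j l : Fin n) (c : ℤ) → j ≢ l →
    det (setColumn M j (λ r → M r j + c * M r l)) ≡ det M
  det-add-column-multiple M j l c j≢l =
    trans (det-transpose (setRow (transpose M) j _))
          (trans (det-add-row-multiple (transpose M) j l c j≢l) (det-transpose M))

  -- Subtracting row u from row v and then adding column v to column u clears row v off the diagonal.
  det-twins : ∀ {m} (M : Matrix (suc m)) (u v : Fin (suc m)) → u ≢ v →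
    (∀ j → j ≢ u → j ≢ v → M u j ≡ M v j) → M v u + M v v ≡ M u u + M u v →
    det M ≡ (M v v - M u v) * det (minor (setColumn M u (λ r → M r u + M r v)) v v)
  det-twins M u v u≢v rows-agree balanced = begin
    det M                                               ≡⟨ sym (det-add-row-multiple M v u -1ℤ v≢u) ⟩
    det R                                               ≡⟨ sym (det-add-column-multiple R u v 1ℤ u≢v) ⟩
    det C                                               ≡⟨ det-sparse-row C v v Cᵥ-sparse ⟩
    sgn (toℕ v ℕ.+ toℕ v) * (C v v * det (minor C v v)) ≡⟨ cong (_* (C v v * det (minor C v v))) (sgn-double (toℕ v)) ⟩
    1ℤ * (C v v * det (minor C v v))                    ≡⟨ *-identityˡ _ ⟩
    C v v * det (minor C v v)                           ≡⟨ cong₂ _*_ Cᵥᵥ (det-cong minor-C) ⟩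
    (M v v - M u v) * det (minor (setColumn M u (λ r → M r u + M r v)) v v) ∎
    where
    open ≡-Reasoning
    v≢u : v ≢ u
    v≢u v≡u = u≢v (sym v≡u)
    R = setRow M v (λ s → M v s + -1ℤ * M u s)
    newColumn : Fin _ → ℤ
    newColumn r = R r u + 1ℤ * R r v
    C = setColumn R u newColumn
    Rᵥ : ∀ s → R v s ≡ M v s - M u s
    Rᵥ s = trans (setRow-same M v _ s) (minus (M v s) (M u s))
      where
      minus : ∀ a b → a + -1ℤ * b ≡ a - b
      minus = solve-∀
    Cᵥ-sparse : ∀ j → j ≢ v → C v j ≡ 0ℤ
    Cᵥ-sparse j j≢v with j ≟ u
    ... | yes refl = trans (cong₂ (λ a b → a + 1ℤ * b) (Rᵥ u) (Rᵥ v))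
                           (cancel (M v u) (M u u) (M v v) (M u v) balanced)
      where
      cancel : ∀ a b c d → a + c ≡ b + d → (a - b) + 1ℤ * (c - d) ≡ 0ℤ
      cancel a b c d eq = trans (regroup a b c d) (trans (cong (_- (b + d)) eq) (self (b + d)))
        where
        regroup : ∀ a b c d → (a - b) + 1ℤ * (c - d) ≡ (a + c) - (b + d)
        regroup = solve-∀
        self : ∀ x → x - x ≡ 0ℤ
        self = solve-∀
    ... | no j≢u = trans (Rᵥ j) (trans (cong (_-_ (M v j)) (rows-agree j j≢u j≢v)) (self (M v j)))
      where
      self : ∀ x → x - x ≡ 0ℤ
      self = solve-∀
    Cᵥᵥ : C v v ≡ M v v - M u v
    Cᵥᵥ = trans (setRow-other (transpose R) u newColumn v v v≢u) (Rᵥ v)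
    minor-C : ∀ r c → minor C v v r c ≡ minor (setColumn M u (λ r → M r u + M r v)) v v r c
    minor-C r c with punchIn v c ≟ u
    ... | yes _ = trans (cong₂ (λ a b → a + 1ℤ * b) (setRow-other M v _ r′ u r′≢v) (setRow-other M v _ r′ v r′≢v))
                        (cong (_+_ (M r′ u)) (*-identityˡ (M r′ v)))
      where
      r′ = punchIn v r
      r′≢v = punchInᵢ≢i v r
    ... | no _ = setRow-other M v _ (punchIn v r) (punchIn v c) (punchInᵢ≢i v r)

module Weighted where

  open import Defs using (Matrix; sumFin; δ; det; charPoly; laplacian)
  open Sums
  open Determinant
  open import Data.Nat as ℕ using (ℕ; zero; suc)
  open import Data.Fin using (Fin; zero; suc; punchIn; punchOut; _≟_)
  open import Data.Fin.Properties using (punchIn-injective; punchInᵢ≢i; punchIn-punchOut)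
  open import Data.Integer using (ℤ; +_; _+_; _-_; _*_; _^_; 0ℤ; 1ℤ)
  open import Data.Integer.Properties using (+-comm; +-assoc; *-identityˡ; *-zeroˡ; *-assoc; *-distribˡ-+)
  open import Data.Integer.Tactic.RingSolver using (solve-∀)
  open import Data.Product using (∃; ∃₂; _,_; _×_; proj₁; proj₂)
  open import Data.Sum using (_⊎_; inj₁; inj₂)
  open import Data.Empty using (⊥; ⊥-elim)
  open import Relation.Nullary using (¬_; Dec; yes; no)
  open import Relation.Binary.PropositionalEquality

  -- With t i = x - deg i and w = 1 this is x I - L; merging twins preserves the shape,
  -- w j counting the original vertices merged into j.
  weighted : ∀ {m} → (Fin m → ℤ) → Matrix m → (Fin m → ℤ) → Matrix m
  weighted t a w i j with i ≟ j
  ... | yes _ = t i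
  ... | no _  = a i j * w j

  weighted-diag : ∀ {m} t a w (i j : Fin m) → i ≡ j → weighted t a w i j ≡ t i
  weighted-diag t a w i j i≡j with i ≟ j
  ... | yes _   = refl
  ... | no i≢j  = ⊥-elim (i≢j i≡j)

  weighted-off : ∀ {m} t a w (i j : Fin m) → i ≢ j → weighted t a w i j ≡ a i j * w j
  weighted-off t a w i j i≢j with i ≟ j
  ... | yes i≡j = ⊥-elim (i≢j i≡j)
  ... | no _    = refl

  addAt : ∀ {m} → (Fin m → ℤ) → Fin m → ℤ → Fin m → ℤ
  addAt f u c i with i ≟ u
  ... | yes _ = f i + c
  ... | no _  = f i

  addAt-same : ∀ {m} f (u : Fin m) c i → i ≡ u → addAt f u c i ≡ f i + c
  addAt-same f u c i i≡u with i ≟ u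
  ... | yes _   = refl
  ... | no i≢u  = ⊥-elim (i≢u i≡u)

  addAt-other : ∀ {m} f (u : Fin m) c i → i ≢ u → addAt f u c i ≡ f i
  addAt-other f u c i i≢u with i ≟ u
  ... | yes i≡u = ⊥-elim (i≢u i≡u)
  ... | no _    = refl

  restrict : ∀ {m} → Matrix (suc m) → Fin (suc m) → Matrix m
  restrict a v i j = a (punchIn v i) (punchIn v j)

  mergeInto : ∀ {m} → (Fin (suc m) → ℤ) → Fin (suc m) → Fin (suc m) → ℤ → Fin m → ℤ
  mergeInto f u v c i = addAt f u c (punchIn v i)

  sumFin-mergeInto-weighted : ∀ {m} (g w : Fin (suc m) → ℤ) (u v : Fin (suc m)) → u ≢ v → g u ≡ g v →
    sumFin (λ i → g (punchIn v i) * mergeInto w u v (w v) i) ≡ sumFin (λ j → g j * w j)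
  sumFin-mergeInto-weighted g w u v u≢v gᵤ≡gᵥ = begin
    sumFin (λ i → g (punchIn v i) * mergeInto w u v (w v) i)
      ≡⟨ sumFin-cong split ⟩
    sumFin (λ i → gw (punchIn v i) + extra i)
      ≡⟨ sumFin-+ (λ i → gw (punchIn v i)) extra ⟩
    sumFin (λ i → gw (punchIn v i)) + sumFin extra
      ≡⟨ cong (_+_ (sumFin (λ i → gw (punchIn v i)))) (sumFin-single extra u′ (λ i i≢u′ → extra-other i i≢u′)) ⟩
    sumFin (λ i → gw (punchIn v i)) + extra u′
      ≡⟨ cong (_+_ (sumFin (λ i → gw (punchIn v i)))) extra-at-u′ ⟩
    sumFin (λ i → gw (punchIn v i)) + gw v
      ≡⟨ +-comm _ (gw v) ⟩
    gw v + sumFin (λ i → gw (punchIn v i))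
      ≡⟨ sym (sumFin-punchIn gw v) ⟩
    sumFin gw ∎
    where
    open ≡-Reasoning
    gw : Fin _ → ℤ
    gw j = g j * w j
    v≢u : v ≢ u
    v≢u v≡u = u≢v (sym v≡u)
    u′ = punchOut v≢u
    extra : Fin _ → ℤ
    extra i with i ≟ u′
    ... | yes _ = g (punchIn v i) * w v
    ... | no _  = 0ℤ
    extra-other : ∀ i → i ≢ u′ → extra i ≡ 0ℤ
    extra-other i i≢u′ with i ≟ u′
    ... | yes i≡u′ = ⊥-elim (i≢u′ i≡u′)
    ... | no _     = refl
    extra-at-u′ : extra u′ ≡ gw v
    extra-at-u′ with u′ ≟ u′
    ... | yes _   = cong (_* w v) (trans (cong g (punchIn-punchOut v≢u)) gᵤ≡gᵥ)
    ... | no u′≢u′ = ⊥-elim (u′≢u′ refl)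
    split : ∀ i → g (punchIn v i) * mergeInto w u v (w v) i ≡ gw (punchIn v i) + extra i
    split i with i ≟ u′
    ... | yes i≡u′ = trans (cong (g (punchIn v i) *_)
                            (addAt-same w u (w v) _ (trans (cong (punchIn v) i≡u′) (punchIn-punchOut v≢u))))
                          (*-distribˡ-+ (g (punchIn v i)) (w (punchIn v i)) (w v))
    ... | no i≢u′  = trans (cong (g (punchIn v i) *_) (addAt-other w u (w v) _ λ i′≡u →
                            i≢u′ (punchIn-injective v i u′ (trans i′≡u (sym (punchIn-punchOut v≢u))))))
                          (sym (Data.Integer.Properties.+-identityʳ _))

  sumFin-mergeInto : ∀ {m} (w : Fin (suc m) → ℤ) (u v : Fin (suc m)) → u ≢ v →
    sumFin (mergeInto w u v (w v)) ≡ sumFin w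
  sumFin-mergeInto w u v u≢v =
    trans (sumFin-cong (λ i → sym (*-identityˡ (mergeInto w u v (w v) i))))
          (trans (sumFin-mergeInto-weighted (λ _ → 1ℤ) w u v u≢v refl) (sumFin-cong (λ j → *-identityˡ (w j))))

  det-weighted-merge : ∀ {m} (t : Fin (suc m) → ℤ) (a : Matrix (suc m)) (w : Fin (suc m) → ℤ) (u v : Fin (suc m)) →
    u ≢ v → (∀ j → j ≢ u → j ≢ v → a u j ≡ a v j) → (∀ j → j ≢ u → j ≢ v → a j u ≡ a j v) →
    a v u * w u + t v ≡ t u + a u v * w v →
    det (weighted t a w) ≡
      (t v - a u v * w v) * det (weighted (mergeInto t u v (a u v * w v)) (restrict a v) (mergeInto w u v (w v)))
  det-weighted-merge t a w u v u≢v rowᵤ≡rowᵥ colᵤ≡colᵥ balanced =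
    trans (det-twins F u v u≢v rows-agree F-balanced)
          (cong₂ _*_ (cong₂ _-_ (weighted-diag t a w v v refl) (weighted-off t a w u v u≢v)) (det-cong entries))
    where
    F = weighted t a w
    v≢u : v ≢ u
    v≢u v≡u = u≢v (sym v≡u)
    rows-agree : ∀ j → j ≢ u → j ≢ v → F u j ≡ F v j
    rows-agree j j≢u j≢v =
      trans (weighted-off t a w u j (λ u≡j → j≢u (sym u≡j)))
            (trans (cong (_* w j) (rowᵤ≡rowᵥ j j≢u j≢v)) (sym (weighted-off t a w v j (λ v≡j → j≢v (sym v≡j)))))
    F-balanced : F v u + F v v ≡ F u u + F u v
    F-balanced = trans (cong₂ _+_ (weighted-off t a w v u v≢u) (weighted-diag t a w v v refl))
                       (trans balanced (sym (cong₂ _+_ (weighted-diag t a w u u refl) (weighted-off t a w u v u≢v))))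
    t′ = mergeInto t u v (a u v * w v)
    w′ = mergeInto w u v (w v)
    entries : ∀ r c → minor (setColumn F u (λ r → F r u + F r v)) v v r c ≡ weighted t′ (restrict a v) w′ r c
    entries r c with punchIn v c ≟ u | r ≟ c
    ... | yes c′≡u | yes r≡c = begin
      F r′ u + F r′ v              ≡⟨ cong₂ _+_ (weighted-diag t a w r′ u r′≡u) (weighted-off t a w r′ v r′≢v) ⟩
      t r′ + a r′ v * w v          ≡⟨ cong (λ z → t r′ + a z v * w v) r′≡u ⟩
      t r′ + a u v * w v           ≡⟨ sym (addAt-same t u _ r′ r′≡u) ⟩
      t′ r                         ∎
      where
      open ≡-Reasoning
      r′ = punchIn v r
      r′≢v = punchInᵢ≢i v r
      r′≡u : r′ ≡ u
      r′≡u = trans (cong (punchIn v) r≡c) c′≡u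
    ... | yes c′≡u | no r≢c = begin
      F r′ u + F r′ v              ≡⟨ cong₂ _+_ (weighted-off t a w r′ u r′≢u) (weighted-off t a w r′ v r′≢v) ⟩
      a r′ u * w u + a r′ v * w v  ≡⟨ cong (λ z → a r′ u * w u + z * w v) (sym (colᵤ≡colᵥ r′ r′≢u r′≢v)) ⟩
      a r′ u * w u + a r′ u * w v  ≡⟨ sym (*-distribˡ-+ (a r′ u) (w u) (w v)) ⟩
      a r′ u * (w u + w v)         ≡⟨ cong₂ _*_ (cong (a r′) (sym c′≡u))
                                                (trans (sym (addAt-same w u (w v) u refl)) (cong (addAt w u (w v)) (sym c′≡u))) ⟩
      a r′ c′ * w′ c               ∎
      where
      open ≡-Reasoning
      r′ = punchIn v r
      c′ = punchIn v c
      r′≢v = punchInᵢ≢i v r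
      r′≢u : r′ ≢ u
      r′≢u r′≡u = r≢c (punchIn-injective v r c (trans r′≡u (sym c′≡u)))
    ... | no c′≢u | yes r≡c =
      trans (weighted-diag t a w (punchIn v r) (punchIn v c) (cong (punchIn v) r≡c))
            (sym (addAt-other t u _ (punchIn v r) (λ r′≡u → c′≢u (trans (cong (punchIn v) (sym r≡c)) r′≡u))))
    ... | no c′≢u | no r≢c =
      trans (weighted-off t a w (punchIn v r) (punchIn v c) (λ eq → r≢c (punchIn-injective v r c eq)))
            (cong (a (punchIn v r) (punchIn v c) *_) (sym (addAt-other w u (w v) (punchIn v c) c′≢u)))

  det₁ : (M : Matrix 1) → det M ≡ M zero zero
  det₁ M = expand (M zero zero)
    where
    expand : ∀ a → 1ℤ * (a * 1ℤ) + 0ℤ ≡ a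
    expand = solve-∀

  mergeInto-shift : ∀ {m} (t w : Fin (suc m) → ℤ) (y : ℤ) (u v : Fin (suc m)) (c d : ℤ) i →
    t (punchIn v i) ≡ y + w (punchIn v i) → c ≡ d → mergeInto t u v c i ≡ y + mergeInto w u v d i
  mergeInto-shift t w y u v c d i t≡y+w c≡d with punchIn v i ≟ u
  ... | yes _ = trans (cong₂ _+_ t≡y+w c≡d) (+-assoc y (w (punchIn v i)) d)
  ... | no _  = t≡y+w

  det-weighted-complete : ∀ {m} (y : ℤ) (t : Fin (suc m) → ℤ) (a : Matrix (suc m)) (w : Fin (suc m) → ℤ) →
    (∀ i j → i ≢ j → a i j ≡ 1ℤ) → (∀ i → t i ≡ y + w i) →
    det (weighted t a w) ≡ y ^ m * (y + sumFin w)
  det-weighted-complete {zero} y t a w a≡1 t≡y+w =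
    trans (det₁ (weighted t a w))
          (trans (weighted-diag t a w zero zero refl) (trans (t≡y+w zero) (unit y (w zero))))
    where
    unit : ∀ y a → y + a ≡ 1ℤ * (y + (a + 0ℤ))
    unit = solve-∀
  det-weighted-complete {suc m} y t a w a≡1 t≡y+w = begin
    det (weighted t a w)
      ≡⟨ det-weighted-merge t a w u v (λ ()) (λ j j≢u j≢v → trans (a≡1 u j (≢-sym j≢u)) (sym (a≡1 v j (≢-sym j≢v))))
                                             (λ j j≢u j≢v → trans (a≡1 j u j≢u) (sym (a≡1 j v j≢v)))
                                             balanced ⟩
    (t v - a u v * w v) * det (weighted (mergeInto t u v (a u v * w v)) (restrict a v) (mergeInto w u v (w v)))
      ≡⟨ cong₂ _*_ pivot (det-weighted-complete y _ (restrict a v) _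
                            (λ i j i≢j → a≡1 _ _ (λ eq → i≢j (punchIn-injective v i j eq)))
                            (λ i → mergeInto-shift t w y u v _ (w v) i (t≡y+w (punchIn v i))
                                     (trans (cong (_* w v) (a≡1 u v (λ ()))) (*-identityˡ (w v))))) ⟩
    y * (y ^ m * (y + sumFin (mergeInto w u v (w v))))
      ≡⟨ cong (λ s → y * (y ^ m * (y + s))) (sumFin-mergeInto w u v (λ ())) ⟩
    y * (y ^ m * (y + sumFin w))
      ≡⟨ sym (*-assoc y (y ^ m) (y + sumFin w)) ⟩
    y ^ suc m * (y + sumFin w) ∎
    where
    open ≡-Reasoning
    u v : Fin (suc (suc m))
    u = zero
    v = suc zero
    balanced : a v u * w u + t v ≡ t u + a u v * w v
    balanced rewrite a≡1 v u (λ ()) | a≡1 u v (λ ()) | t≡y+w u | t≡y+w v = shuffle y (w u) (w v)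
      where
      shuffle : ∀ y a b → 1ℤ * a + (y + b) ≡ (y + a) + 1ℤ * b
      shuffle = solve-∀
    pivot : t v - a u v * w v ≡ y
    pivot rewrite a≡1 u v (λ ()) | t≡y+w v = cancel y (w v)
      where
      cancel : ∀ y b → (y + b) - 1ℤ * b ≡ y
      cancel = solve-∀

  record IsStar {m} (x N : ℤ) (t : Fin m → ℤ) (a : Matrix m) (w : Fin m → ℤ) (z : Fin m) : Set where
    field
      hub-row      : ∀ j → j ≢ z → a z j ≡ 1ℤ
      hub-column   : ∀ j → j ≢ z → a j z ≡ 1ℤ
      leaves-apart : ∀ i j → i ≢ j → i ≢ z → j ≢ z → a i j ≡ 0ℤ
      leaf-diag    : ∀ i → i ≢ z → t i ≡ x - 1ℤ
      hub-diag     : t z ≡ x - N + 1ℤ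
      hub-weight   : w z ≡ 1ℤ
      total-weight : sumFin w ≡ N

  punchIn-≢ : ∀ {n} (v : Fin (suc n)) {z : Fin (suc n)} (v≢z : v ≢ z) j → j ≢ punchOut v≢z → punchIn v j ≢ z
  punchIn-≢ v v≢z j j≢z′ j′≡z = j≢z′ (punchIn-injective v j (punchOut v≢z) (trans j′≡z (sym (punchIn-punchOut v≢z))))

  merge-star : ∀ {m} {x N : ℤ} {t : Fin (suc m) → ℤ} {a : Matrix (suc m)} {w : Fin (suc m) → ℤ} {z u v : Fin (suc m)} →
    IsStar x N t a w z → u ≢ v → u ≢ z → (v≢z : v ≢ z) →
    IsStar x N (mergeInto t u v (a u v * w v)) (restrict a v) (mergeInto w u v (w v)) (punchOut v≢z)
  merge-star {t = t} {a} {w} {z} {u} {v} star u≢v u≢z v≢z = record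
    { hub-row      = λ j j≢z → trans (cong (λ r → a r (punchIn v j)) z′↦z) (hub-row _ (punchIn-≢ v v≢z j j≢z))
    ; hub-column   = λ j j≢z → trans (cong (a (punchIn v j)) z′↦z) (hub-column _ (punchIn-≢ v v≢z j j≢z))
    ; leaves-apart = λ i j i≢j i≢z j≢z → leaves-apart _ _ (λ eq → i≢j (punchIn-injective v i j eq))
                                           (punchIn-≢ v v≢z i i≢z) (punchIn-≢ v v≢z j j≢z)
    ; leaf-diag    = λ i i≢z → trans (mergeInto-zero i) (leaf-diag _ (punchIn-≢ v v≢z i i≢z))
    ; hub-diag     = trans (mergeInto-zero (punchOut v≢z)) (trans (cong t z′↦z) hub-diag)
    ; hub-weight   = trans (cong (addAt w u (w v)) z′↦z) (trans (addAt-other w u (w v) z (≢-sym u≢z)) hub-weight)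
    ; total-weight = trans (sumFin-mergeInto w u v u≢v) total-weight
    }
    where
    open IsStar star
    z′↦z : punchIn v (punchOut v≢z) ≡ z
    z′↦z = punchIn-punchOut v≢z
    no-edge : a u v * w v ≡ 0ℤ
    no-edge = trans (cong (_* w v) (leaves-apart u v u≢v u≢z v≢z)) (*-zeroˡ (w v))
    mergeInto-zero : ∀ i → mergeInto t u v (a u v * w v) i ≡ t (punchIn v i)
    mergeInto-zero i with punchIn v i ≟ u
    ... | yes _ = trans (cong (_+_ (t (punchIn v i))) no-edge) (Data.Integer.Properties.+-identityʳ _)
    ... | no _  = refl

  det-weighted-star : ∀ k (x N : ℤ) (t : Fin (suc (suc k)) → ℤ) a w z → IsStar x N t a w z →
    det (weighted t a w) ≡ (x - 1ℤ) ^ k * (x * (x - N))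
  det-weighted-star zero x N t a w zero star = trans (det₂ (weighted t a w)) two-by-two
    where
    open IsStar star
    expand : ∀ N′ → N′ ≡ 1ℤ + (w (suc zero) + 0ℤ) →
      (x - N′ + 1ℤ) * (x - 1ℤ) - (1ℤ * w (suc zero)) * (1ℤ * 1ℤ) ≡ 1ℤ * (x * (x - N′))
    expand _ refl = identity x (w (suc zero))
      where
      identity : ∀ x b → (x - (1ℤ + (b + 0ℤ)) + 1ℤ) * (x - 1ℤ) - (1ℤ * b) * (1ℤ * 1ℤ) ≡ 1ℤ * (x * (x - (1ℤ + (b + 0ℤ))))
      identity = solve-∀
    two-by-two : t zero * t (suc zero) - (a zero (suc zero) * w (suc zero)) * (a (suc zero) zero * w zero) ≡ 1ℤ * (x * (x - N))
    two-by-two rewrite hub-diag | leaf-diag (suc zero) (λ ()) | hub-row (suc zero) (λ ()) | hub-column (suc zero) (λ ()) | hub-weight =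
      expand N (trans (sym total-weight) (cong (λ h → h + (w (suc zero) + 0ℤ)) hub-weight))
  det-weighted-star zero x N t a w (suc zero) star = trans (det₂ (weighted t a w)) two-by-two
    where
    open IsStar star
    expand : ∀ N′ → N′ ≡ w zero + (1ℤ + 0ℤ) →
      (x - 1ℤ) * (x - N′ + 1ℤ) - (1ℤ * 1ℤ) * (1ℤ * w zero) ≡ 1ℤ * (x * (x - N′))
    expand _ refl = identity x (w zero)
      where
      identity : ∀ x b → (x - 1ℤ) * (x - (b + (1ℤ + 0ℤ)) + 1ℤ) - (1ℤ * 1ℤ) * (1ℤ * b) ≡ 1ℤ * (x * (x - (b + (1ℤ + 0ℤ))))
      identity = solve-∀
    two-by-two : t zero * t (suc zero) - (a zero (suc zero) * w (suc zero)) * (a (suc zero) zero * w zero) ≡ 1ℤ * (x * (x - N))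
    two-by-two rewrite hub-diag | leaf-diag zero (λ ()) | hub-row zero (λ ()) | hub-column zero (λ ()) | hub-weight =
      expand N (trans (sym total-weight) (cong (λ h → w zero + (h + 0ℤ)) hub-weight))
  det-weighted-star (suc k) x N t a w z star = begin
    det (weighted t a w)
      ≡⟨ det-weighted-merge t a w u v u≢v rows-agree columns-agree balanced ⟩
    (t v - a u v * w v) * det (weighted (mergeInto t u v (a u v * w v)) (restrict a v) (mergeInto w u v (w v)))
      ≡⟨ cong₂ _*_ pivot (det-weighted-star k x N _ _ _ _ (merge-star star u≢v u≢z v≢z)) ⟩
    (x - 1ℤ) * ((x - 1ℤ) ^ k * (x * (x - N)))
      ≡⟨ sym (*-assoc (x - 1ℤ) ((x - 1ℤ) ^ k) (x * (x - N))) ⟩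
    (x - 1ℤ) ^ suc k * (x * (x - N)) ∎
    where
    open ≡-Reasoning
    open IsStar star
    u v : Fin (suc (suc (suc k)))
    u = proj₁ (avoid-two z z)
    v = proj₁ (avoid-two z u)
    u≢z : u ≢ z
    u≢z = proj₁ (proj₂ (avoid-two z z))
    v≢z : v ≢ z
    v≢z = proj₁ (proj₂ (avoid-two z u))
    u≢v : u ≢ v
    u≢v = ≢-sym (proj₂ (proj₂ (avoid-two z u)))
    no-edge : a u v ≡ 0ℤ
    no-edge = leaves-apart u v u≢v u≢z v≢z
    rows-agree : ∀ j → j ≢ u → j ≢ v → a u j ≡ a v j
    rows-agree j j≢u j≢v with j ≟ z
    ... | yes refl = trans (hub-column u u≢z) (sym (hub-column v v≢z))
    ... | no j≢z   = trans (leaves-apart u j (≢-sym j≢u) u≢z j≢z) (sym (leaves-apart v j (≢-sym j≢v) v≢z j≢z))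
    columns-agree : ∀ j → j ≢ u → j ≢ v → a j u ≡ a j v
    columns-agree j j≢u j≢v with j ≟ z
    ... | yes refl = trans (hub-row u u≢z) (sym (hub-row v v≢z))
    ... | no j≢z   = trans (leaves-apart j u j≢u j≢z u≢z) (sym (leaves-apart j v j≢v j≢z v≢z))
    balanced : a v u * w u + t v ≡ t u + a u v * w v
    balanced rewrite leaves-apart v u (≢-sym u≢v) v≢z u≢z | no-edge | leaf-diag u u≢z | leaf-diag v v≢z =
      swap (w u) (x - 1ℤ)
      where
      swap : ∀ a b → 0ℤ * a + b ≡ b + 0ℤ * a
      swap = solve-∀
    pivot : t v - a u v * w v ≡ x - 1ℤ
    pivot rewrite no-edge | leaf-diag v v≢z = drop (x - 1ℤ) (w v)
      where
      drop : ∀ a b → a - 0ℤ * b ≡ a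
      drop = solve-∀

  -- By leaf-transitive the leaves (the vertices other than the hub z) form disjoint cliques.
  record IsWindmill {m} (x P N : ℤ) (t : Fin m → ℤ) (a : Matrix m) (w : Fin m → ℤ) (z : Fin m) : Set where
    field
      hub-row         : ∀ j → j ≢ z → a z j ≡ 1ℤ
      hub-column      : ∀ j → j ≢ z → a j z ≡ 1ℤ
      loopless        : ∀ i → a i i ≡ 0ℤ
      symmetric       : ∀ i j → a i j ≡ a j i
      leaf-edge       : ∀ i j → i ≢ j → i ≢ z → j ≢ z → a i j ≡ 0ℤ ⊎ a i j ≡ 1ℤ
      leaf-transitive : ∀ i j k → i ≢ j → i ≢ k → j ≢ k → i ≢ z → j ≢ z → k ≢ z →
                        a i j ≡ 1ℤ → a i k ≡ a j k
      leaf-diag       : ∀ i → i ≢ z → t i ≡ (x - P) + w i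
      hub-diag        : t z ≡ x - N + 1ℤ
      hub-weight      : w z ≡ 1ℤ
      leaf-closed-weight : ∀ i → i ≢ z → sumFin (λ j → (δ i j + a i j) * w j) ≡ P
      total-weight    : sumFin w ≡ N

  δ-punchIn : ∀ {n} (v : Fin (suc n)) i j → δ (punchIn v i) (punchIn v j) ≡ δ i j
  δ-punchIn v i j with i ≟ j
  ... | yes refl = trans (δ-diag (punchIn v i)) (sym (δ-diag i))
  ... | no i≢j   = trans (δ-off _ _ (λ eq → i≢j (punchIn-injective v i j eq))) (sym (δ-off i j i≢j))

  merge-windmill : ∀ {m} {x P N : ℤ} {t : Fin (suc m) → ℤ} {a : Matrix (suc m)} {w : Fin (suc m) → ℤ} {z u v : Fin (suc m)} →
    IsWindmill x P N t a w z → u ≢ v → u ≢ z → (v≢z : v ≢ z) → a u v ≡ 1ℤ →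
    IsWindmill x P N (mergeInto t u v (a u v * w v)) (restrict a v) (mergeInto w u v (w v)) (punchOut v≢z)
  merge-windmill {x = x} {P} {N} {t} {a} {w} {z} {u} {v} windmill u≢v u≢z v≢z aᵤᵥ≡1 = record
    { hub-row         = λ j j≢z → trans (cong (λ r → a r (punchIn v j)) z′↦z) (hub-row _ (outside j j≢z))
    ; hub-column      = λ j j≢z → trans (cong (a (punchIn v j)) z′↦z) (hub-column _ (outside j j≢z))
    ; loopless        = λ i → loopless _
    ; symmetric       = λ i j → symmetric _ _
    ; leaf-edge       = λ i j i≢j i≢z j≢z → leaf-edge _ _ (punchIn-≢′ i≢j) (outside i i≢z) (outside j j≢z)
    ; leaf-transitive = λ i j k i≢j i≢k j≢k i≢z j≢z k≢z →
                          leaf-transitive _ _ _ (punchIn-≢′ i≢j) (punchIn-≢′ i≢k) (punchIn-≢′ j≢k)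
                                          (outside i i≢z) (outside j j≢z) (outside k k≢z)
    ; leaf-diag       = λ i i≢z → mergeInto-shift t w (x - P) u v (a u v * w v) (w v) i
                                    (leaf-diag _ (outside i i≢z)) edge-weight
    ; hub-diag        = trans (cong (addAt t u _) z′↦z) (trans (addAt-other t u _ z (≢-sym u≢z)) hub-diag)
    ; hub-weight      = trans (cong (addAt w u (w v)) z′↦z) (trans (addAt-other w u (w v) z (≢-sym u≢z)) hub-weight)
    ; leaf-closed-weight = λ i i≢z → let r = punchIn v i in
        trans (sumFin-cong (λ j → cong (λ d → (d + a r (punchIn v j)) * mergeInto w u v (w v) j) (sym (δ-punchIn v i j))))
              (trans (sumFin-mergeInto-weighted (λ j → δ r j + a r j) w u v u≢v (closed-twins r (outside i i≢z) (punchInᵢ≢i v i)))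
                     (leaf-closed-weight r (outside i i≢z)))
    ; total-weight    = trans (sumFin-mergeInto w u v u≢v) total-weight
    }
    where
    open IsWindmill windmill
    z′↦z : punchIn v (punchOut v≢z) ≡ z
    z′↦z = punchIn-punchOut v≢z
    outside : ∀ j → j ≢ punchOut v≢z → punchIn v j ≢ z
    outside = punchIn-≢ v v≢z
    punchIn-≢′ : ∀ {i j} → i ≢ j → punchIn v i ≢ punchIn v j
    punchIn-≢′ {i} {j} i≢j eq = i≢j (punchIn-injective v i j eq)
    edge-weight : a u v * w v ≡ w v
    edge-weight = trans (cong (_* w v) aᵤᵥ≡1) (*-identityˡ (w v))
    closed-twins : ∀ r → r ≢ z → r ≢ v → δ r u + a r u ≡ δ r v + a r v
    closed-twins r r≢z r≢v with r ≟ u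
    ... | yes refl = trans (cong₂ _+_ (δ-diag u) (loopless u)) (sym (cong₂ _+_ (δ-off u v u≢v) aᵤᵥ≡1))
    ... | no r≢u   = cong₂ _+_ (trans (δ-off r u r≢u) (sym (δ-off r v r≢v)))
                      (trans (symmetric r u) (trans (leaf-transitive u v r u≢v (≢-sym r≢u) (≢-sym r≢v) u≢z v≢z r≢z aᵤᵥ≡1)
                                                    (symmetric v r)))

  LeafEdge : ∀ {m} → Matrix m → Fin m → Set
  LeafEdge a z = ∃ λ u → ∃ λ v → u ≢ v × u ≢ z × v ≢ z × a u v ≡ 1ℤ

  leafEdge? : ∀ {m} (a : Matrix m) (z : Fin m) → Dec (LeafEdge a z)
  leafEdge? a z = any? λ u → any? λ v → ¬? (u ≟ v) ×-dec ¬? (u ≟ z) ×-dec ¬? (v ≟ z) ×-dec (a u v ℤ.≟ 1ℤ)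
    where
    open import Data.Fin.Properties using (any?)
    open import Relation.Nullary.Decidable using (_×-dec_; ¬?)
    import Data.Integer.Properties as ℤ

  module _ {m} {x P N : ℤ} {t : Fin (suc m) → ℤ} {a : Matrix (suc m)} {w : Fin (suc m) → ℤ} {z : Fin (suc m)}
           (windmill : IsWindmill x P N t a w z) (no-leaf-edge : ¬ LeafEdge a z) where
    open IsWindmill windmill

    leaves-apart : ∀ i j → i ≢ j → i ≢ z → j ≢ z → a i j ≡ 0ℤ
    leaves-apart i j i≢j i≢z j≢z with leaf-edge i j i≢j i≢z j≢z
    ... | inj₁ aᵢⱼ≡0 = aᵢⱼ≡0
    ... | inj₂ aᵢⱼ≡1 = ⊥-elim (no-leaf-edge (i , j , i≢j , i≢z , j≢z , aᵢⱼ≡1))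

    -- The closed neighbourhood of a leaf is the leaf and the hub.
    leaf-weight : ∀ i → i ≢ z → w i ≡ P - 1ℤ
    leaf-weight i i≢z = begin
      w i                                  ≡⟨ solve-leaf (w i) ⟩
      ((1ℤ + 0ℤ) * w i + (0ℤ + 1ℤ) * 1ℤ) - 1ℤ
        ≡⟨ cong (_- 1ℤ) (sym (cong₂ _+_ (cong₂ (λ d e → (d + e) * w i) (δ-diag i) (loopless i))
                                         (cong₂ _*_ (cong₂ _+_ (δ-off i z i≢z) (hub-column i i≢z)) hub-weight))) ⟩
      (f i + f z) - 1ℤ                     ≡⟨ cong (_- 1ℤ) (sym (sumFin-pair f i z i≢z off-neighbourhood)) ⟩
      sumFin f - 1ℤ                        ≡⟨ cong (_- 1ℤ) (leaf-closed-weight i i≢z) ⟩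
      P - 1ℤ                               ∎
      where
      open ≡-Reasoning
      f : Fin (suc m) → ℤ
      f j = (δ i j + a i j) * w j
      solve-leaf : ∀ b → b ≡ ((1ℤ + 0ℤ) * b + (0ℤ + 1ℤ) * 1ℤ) - 1ℤ
      solve-leaf = solve-∀
      off-neighbourhood : ∀ j → j ≢ i → j ≢ z → f j ≡ 0ℤ
      off-neighbourhood j j≢i j≢z =
        trans (cong₂ (λ d e → (d + e) * w j) (δ-off i j (≢-sym j≢i)) (leaves-apart i j (≢-sym j≢i) i≢z j≢z))
              (*-zeroˡ (w j))

    total-weight-leaves : N ≡ 1ℤ + + m * (P - 1ℤ)
    total-weight-leaves = begin
      N                                         ≡⟨ sym total-weight ⟩
      sumFin w                                  ≡⟨ sumFin-punchIn w z ⟩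
      w z + sumFin (λ i → w (punchIn z i))      ≡⟨ cong₂ _+_ hub-weight
                                                     (sumFin-const (P - 1ℤ) _ (λ i → leaf-weight _ (punchInᵢ≢i z i))) ⟩
      1ℤ + + m * (P - 1ℤ)                       ∎
      where open ≡-Reasoning

    windmill→star : IsStar x N t a w z
    windmill→star = record
      { hub-row      = hub-row
      ; hub-column   = hub-column
      ; leaves-apart = leaves-apart
      ; leaf-diag    = λ i i≢z → trans (leaf-diag i i≢z) (trans (cong (_+_ (x - P)) (leaf-weight i i≢z)) (cancel x P))
      ; hub-diag     = hub-diag
      ; hub-weight   = hub-weight
      ; total-weight = total-weight
      }
      where
      cancel : ∀ x P → (x - P) + (P - 1ℤ) ≡ x - 1ℤ
      cancel = solve-∀

  det-weighted-merge-leaves : ∀ {m} {x P N : ℤ} {t : Fin (suc m) → ℤ} {a : Matrix (suc m)} {w : Fin (suc m) → ℤ} {z u v : Fin (suc m)} →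
    IsWindmill x P N t a w z → u ≢ v → u ≢ z → v ≢ z → a u v ≡ 1ℤ →
    det (weighted t a w) ≡ (x - P) * det (weighted (mergeInto t u v (a u v * w v)) (restrict a v) (mergeInto w u v (w v)))
  det-weighted-merge-leaves {x = x} {P} {t = t} {a} {w} {z} {u} {v} windmill u≢v u≢z v≢z aᵤᵥ≡1 =
    trans (det-weighted-merge t a w u v u≢v rows-agree columns-agree balanced) (cong (_* _) pivot)
    where
    open IsWindmill windmill
    rows-agree : ∀ j → j ≢ u → j ≢ v → a u j ≡ a v j
    rows-agree j j≢u j≢v with j ≟ z
    ... | yes j≡z = trans (cong (a u) j≡z) (trans (hub-column u u≢z) (sym (trans (cong (a v) j≡z) (hub-column v v≢z))))
    ... | no j≢z  = leaf-transitive u v j u≢v (≢-sym j≢u) (≢-sym j≢v) u≢z v≢z j≢z aᵤᵥ≡1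
    columns-agree : ∀ j → j ≢ u → j ≢ v → a j u ≡ a j v
    columns-agree j j≢u j≢v = trans (symmetric j u) (trans (rows-agree j j≢u j≢v) (symmetric v j))
    balanced : a v u * w u + t v ≡ t u + a u v * w v
    balanced = begin
      a v u * w u + t v                ≡⟨ cong₂ (λ b d → b * w u + d) (trans (symmetric v u) aᵤᵥ≡1) (leaf-diag v v≢z) ⟩
      1ℤ * w u + ((x - P) + w v)       ≡⟨ swap (x - P) (w u) (w v) ⟩
      ((x - P) + w u) + 1ℤ * w v       ≡⟨ cong₂ (λ d b → d + b * w v) (sym (leaf-diag u u≢z)) (sym aᵤᵥ≡1) ⟩
      t u + a u v * w v                ∎
      where
      open ≡-Reasoning
      swap : ∀ y a b → 1ℤ * a + (y + b) ≡ (y + a) + 1ℤ * b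
      swap = solve-∀
    pivot : t v - a u v * w v ≡ x - P
    pivot = trans (cong₂ (λ d b → d - b * w v) (leaf-diag v v≢z) aᵤᵥ≡1) (cancel (x - P) (w v))
      where
      cancel : ∀ y b → (y + b) - 1ℤ * b ≡ y
      cancel = solve-∀

  det-weighted-windmill : ∀ m (x P N : ℤ) t a (w : Fin (suc (suc m)) → ℤ) z → IsWindmill x P N t a w z →
    ∃₂ λ e k → e ℕ.+ k ≡ m × N ≡ 1ℤ + + suc k * (P - 1ℤ) ×
               det (weighted t a w) ≡ (x - P) ^ e * ((x - 1ℤ) ^ k * (x * (x - N)))
  det-weighted-windmill m x P N t a w z windmill with leafEdge? a z
  ... | no no-leaf-edge =
    0 , m , refl , total-weight-leaves windmill no-leaf-edge ,
    trans (det-weighted-star m x N t a w z (windmill→star windmill no-leaf-edge)) (sym (*-identityˡ _))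
  det-weighted-windmill zero x P N t a w z windmill | yes (u , v , u≢v , u≢z , v≢z , _) = ⊥-elim (two-distinct u v z u≢v u≢z v≢z)
    where
    two-distinct : (u v z : Fin 2) → u ≢ v → u ≢ z → v ≢ z → ⊥
    two-distinct zero       zero       _          u≢v _   _   = u≢v refl
    two-distinct (suc zero) (suc zero) _          u≢v _   _   = u≢v refl
    two-distinct zero       (suc zero) zero       _   u≢z _   = u≢z refl
    two-distinct zero       (suc zero) (suc zero) _   _   v≢z = v≢z refl
    two-distinct (suc zero) zero       zero       _   _   v≢z = v≢z refl
    two-distinct (suc zero) zero       (suc zero) _   u≢z _   = u≢z refl
  det-weighted-windmill (suc m) x P N t a w z windmill | yes (u , v , u≢v , u≢z , v≢z , aᵤᵥ≡1) =
    let e , k , e+k≡m , N≡ , det≡ = det-weighted-windmill m x P N _ _ _ _ (merge-windmill windmill u≢v u≢z v≢z aᵤᵥ≡1)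
    in suc e , k , cong suc e+k≡m , N≡ ,
       trans (det-weighted-merge-leaves windmill u≢v u≢z v≢z aᵤᵥ≡1)
             (trans (cong ((x - P) *_) det≡) (sym (*-assoc (x - P) ((x - P) ^ e) _)))

  charPoly-laplacian : ∀ {m} (A : Matrix m) (x : ℤ) → (∀ i → A i i ≡ 0ℤ) →
    charPoly (laplacian A) x ≡ det (weighted (λ i → x - sumFin (A i)) A (λ _ → 1ℤ))
  charPoly-laplacian A x loopless = det-cong entry
    where
    entry : ∀ i j → x * δ i j - (δ i j * sumFin (A i) - A i j) ≡ weighted (λ i → x - sumFin (A i)) A (λ _ → 1ℤ) i j
    entry i j with i ≟ j
    ... | yes refl rewrite δ-diag i | loopless i = diagonal x (sumFin (A i))
      where
      diagonal : ∀ x d → x * 1ℤ - (1ℤ * d - 0ℤ) ≡ x - d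
      diagonal = solve-∀
    ... | no i≢j rewrite δ-off i j i≢j = off-diagonal x (sumFin (A i)) (A i j)
      where
      off-diagonal : ∀ x d a → x * 0ℤ - (0ℤ * d - a) ≡ a * 1ℤ
      off-diagonal = solve-∀

module GroupOrder where

  open import Defs using (pow; IsEnumeration; sumFin)
  open Sums
  open import Data.Nat as ℕ using (ℕ; zero; suc; _+_; _*_; _∸_; _<_; _≤_; s≤s; NonZero)
  import Data.Nat.Properties as ℕ
  open import Data.Nat.DivMod using (_%_; _/_; m≡m%n+[m/n]*n; m%n<n)
  open import Data.Nat.Divisibility using (_∣_; divides)
  open import Data.Nat.Primality using (Prime; prime⇒nonTrivial)
  open import Data.Nat.Coprimality using (prime⇒coprime; coprime-Bézout)
  open import Data.Nat.GCD using (module Bézout)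
  open import Data.Fin as Fin using (Fin; zero; suc; toℕ; fromℕ<)
  open import Data.Fin.Properties using (any?; pigeonhole; toℕ-fromℕ<; toℕ<n; toℕ-injective)
  open import Data.Integer as ℤ using (ℤ; +_; 1ℤ)
  import Data.Integer.Properties as ℤ
  open import Data.Product using (∃; _,_; _×_; proj₁; proj₂)
  open import Data.Sum using (inj₁; inj₂)
  open import Data.Empty using (⊥-elim)
  open import Relation.Nullary using (¬_; Dec; yes; no)
  open import Relation.Binary.PropositionalEquality as ≡ using (_≡_)
  open import Relation.Binary.Definitions using (tri<; tri≈; tri>)
  open import Algebra.Bundles using (Group)
  import Relation.Binary.Reasoning.Setoid

  least : ∀ {n p} (Q : Fin n → Set p) → (∀ j → Dec (Q j)) → ∃ Q → ∃ λ k → Q k × (∀ j → toℕ j < toℕ k → ¬ Q j)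
  least {suc n} Q Q? witness with Q? zero
  ... | yes q₀ = zero , q₀ , λ j ()
  ... | no ¬q₀ with witness
  ...   | zero , q₀ = ⊥-elim (¬q₀ q₀)
  ...   | suc k , qₖ with least (λ j → Q (suc j)) (λ j → Q? (suc j)) (k , qₖ)
  ...     | l , qₗ , below = suc l , qₗ , λ { zero _ → ¬q₀ ; (suc j) (s≤s j<l) → below j j<l }

  least-unique : ∀ {n p} {Q : Fin n → Set p} {k l : Fin n} →
    Q k → (∀ j → toℕ j < toℕ k → ¬ Q j) → Q l → (∀ j → toℕ j < toℕ l → ¬ Q j) → k ≡ l
  least-unique {k = k} {l} qₖ below-k qₗ below-l with ℕ.<-cmp (toℕ k) (toℕ l)
  ... | tri< k<l _ _ = ⊥-elim (below-l k k<l qₖ)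
  ... | tri≈ _ k≡l _ = toℕ-injective k≡l
  ... | tri> _ _ l<k = ⊥-elim (below-k l l<k qₗ)

  module Powers {c ℓ} (G : Group c ℓ) where
    open Group G renaming (refl to ≈-refl; sym to ≈-sym; trans to ≈-trans) hiding (_-_)
    open import Algebra.Properties.Monoid.Mult monoid using (×-congʳ; ×-homo-+; ×-assocˡ) renaming (_×_ to _·_)
    open import Algebra.Properties.Group G using (identityˡ-unique)
    open import Relation.Binary.Reasoning.Setoid setoid

    -- The library writes powers additively, as k · g; Defs.pow agrees with it by pow≡^.
    infixr 8 _^_
    _^_ : Carrier → ℕ → Carrier
    g ^ k = k · g

    pow≡^ : ∀ k g → pow G k g ≡ g ^ k
    pow≡^ zero    g = ≡.refl
    pow≡^ (suc k) g = ≡.cong (g ∙_) (pow≡^ k g)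

    ^-cong : ∀ k {g h} → g ≈ h → g ^ k ≈ h ^ k
    ^-cong = ×-congʳ

    ^-+ : ∀ g a b → g ^ (a + b) ≈ g ^ a ∙ g ^ b
    ^-+ g a b = ×-homo-+ g a b

    ^-* : ∀ g a k → (g ^ a) ^ k ≈ g ^ (k * a)
    ^-* g a k = ×-assocˡ g k a

    ε-^ : ∀ k → ε ^ k ≈ ε
    ε-^ zero    = ≈-refl
    ε-^ (suc k) = ≈-trans (identityˡ _) (ε-^ k)

    ^-periodic : ∀ {g o} → g ^ o ≈ ε → ∀ m k → g ^ (m + k * o) ≈ g ^ m
    ^-periodic {g} {o} gᵒ≈ε m k = begin
      g ^ (m + k * o)       ≈⟨ ^-+ g m (k * o) ⟩
      g ^ m ∙ g ^ (k * o)   ≈⟨ ∙-congˡ (≈-sym (^-* g o k)) ⟩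
      g ^ m ∙ (g ^ o) ^ k   ≈⟨ ∙-congˡ (≈-trans (^-cong k gᵒ≈ε) (ε-^ k)) ⟩
      g ^ m ∙ ε             ≈⟨ identityʳ _ ⟩
      g ^ m                 ∎

    ^-∸ : ∀ {g a b} → a ≤ b → g ^ a ≈ g ^ b → g ^ (b ∸ a) ≈ ε
    ^-∸ {g} {a} {b} a≤b gᵃ≈gᵇ = identityˡ-unique (g ^ (b ∸ a)) (g ^ a) (begin
      g ^ (b ∸ a) ∙ g ^ a   ≈⟨ ≈-sym (^-+ g (b ∸ a) a) ⟩
      g ^ (b ∸ a + a)       ≡⟨ ≡.cong (g ^_) (ℕ.m∸n+n≡m a≤b) ⟩
      g ^ b                 ≈⟨ ≈-sym gᵃ≈gᵇ ⟩
      g ^ a                 ∎)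

  module Order {c ℓ} (G : Group c ℓ) {n : ℕ} (e : Fin n → Group.Carrier G) (enum : IsEnumeration G e) where
    open Group G renaming (refl to ≈-refl; sym to ≈-sym; trans to ≈-trans) hiding (_-_)
    open Powers G public
    open import Algebra.Properties.Group G using (∙-cancelˡ)
    module ≈-Reasoning = Relation.Binary.Reasoning.Setoid setoid

    index : Carrier → Fin n
    index g = proj₁ (proj₂ enum g)

    index-spec : ∀ g → e (index g) ≈ g
    index-spec g = proj₂ (proj₂ enum g)

    e-injective : ∀ i j → e i ≈ e j → i ≡ j
    e-injective = proj₁ enum

    index-unique : ∀ g j → e j ≈ g → index g ≡ j
    index-unique g j eⱼ≈g = e-injective _ _ (≈-trans (index-spec g) (≈-sym eⱼ≈g))

    index-≈ : ∀ {g h} → index g ≡ index h → g ≈ h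
    index-≈ {g} {h} eq = ≈-trans (≈-sym (index-spec g)) (≈-trans (reflexive (≡.cong e eq)) (index-spec h))

    _≈?_ : ∀ g h → Dec (g ≈ h)
    g ≈? h with index g Fin.≟ index h
    ... | yes eq = yes (index-≈ eq)
    ... | no neq = no (λ g≈h → neq (index-unique g (index h) (≈-trans (index-spec h) (≈-sym g≈h))))

    -- Among the n + 1 powers g⁰, …, gⁿ two coincide.
    period : ∀ g → ∃ λ (k : Fin n) → g ^ suc (toℕ k) ≈ ε
    period g with pigeonhole (ℕ.n<1+n n) (λ i → index (g ^ toℕ i))
    ... | i , j , i<j , eq =
      fromℕ< k<n , ≡.subst (λ d → g ^ d ≈ ε) d≡1+k (^-∸ (ℕ.<⇒≤ i<j) (index-≈ eq))
      where
      d = toℕ j ∸ toℕ i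
      instance
        d≢0 : NonZero d
        d≢0 = ℕ.>-nonZero (ℕ.m<n⇒0<n∸m i<j)
      k<n : ℕ.pred d < n
      k<n = ℕ.<-≤-trans (ℕ.≤-reflexive (ℕ.suc-pred d)) (ℕ.≤-trans (ℕ.m∸n≤m (toℕ j) (toℕ i)) (ℕ.≤-pred (toℕ<n j)))
      d≡1+k : d ≡ suc (toℕ (fromℕ< k<n))
      d≡1+k = ≡.trans (≡.sym (ℕ.suc-pred d)) (≡.cong suc (≡.sym (toℕ-fromℕ< k<n)))

    private
      leastPeriod : ∀ g → ∃ λ (k : Fin n) → g ^ suc (toℕ k) ≈ ε × (∀ j → toℕ j < toℕ k → ¬ g ^ suc (toℕ j) ≈ ε)
      leastPeriod g = least (λ k → g ^ suc (toℕ k) ≈ ε) (λ k → (g ^ suc (toℕ k)) ≈? ε) (period g)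

    opaque
      order : Carrier → ℕ
      order g = suc (toℕ (proj₁ (leastPeriod g)))

      order≡suc : ∀ g → order g ≡ suc (ℕ.pred (order g))
      order≡suc g = ≡.refl

      ^-order : ∀ g → g ^ order g ≈ ε
      ^-order g = proj₁ (proj₂ (leastPeriod g))

      ^≈ε-below-order : ∀ g {k} → k < order g → g ^ k ≈ ε → k ≡ 0
      ^≈ε-below-order g {zero}  _   _       = ≡.refl
      ^≈ε-below-order g {suc j} k<o gᵏ≈ε = ⊥-elim (proj₂ (proj₂ (leastPeriod g)) (fromℕ< j<n) j′<o
                                                    (≡.subst (λ i → g ^ suc i ≈ ε) (≡.sym (toℕ-fromℕ< j<n)) gᵏ≈ε))
        where
        j<o : j < toℕ (proj₁ (leastPeriod g))
        j<o = ℕ.≤-pred k<o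
        j<n : j < n
        j<n = ℕ.<-trans j<o (toℕ<n _)
        j′<o : toℕ (fromℕ< j<n) < toℕ (proj₁ (leastPeriod g))
        j′<o = ≡.subst (_< _) (≡.sym (toℕ-fromℕ< j<n)) j<o

    instance
      order-nonZero : ∀ {g} → NonZero (order g)
      order-nonZero {g} = ℕ.≢-nonZero (λ order≡0 → ℕ.1+n≢0 (≡.trans (≡.sym (order≡suc g)) order≡0))

    ^-mod : ∀ g m → g ^ m ≈ g ^ (m % order g)
    ^-mod g m = ≈-trans (reflexive (≡.cong (g ^_) (m≡m%n+[m/n]*n m (order g))))
                        (^-periodic (^-order g) (m % order g) (m / order g))

    ^-injective : ∀ g {a b} → a < order g → b < order g → g ^ a ≈ g ^ b → a ≡ b
    ^-injective g {a} {b} a<o b<o gᵃ≈gᵇ with ℕ.≤-total a b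
    ... | inj₁ a≤b = ℕ.≤-antisym a≤b (ℕ.m∸n≡0⇒m≤n (^≈ε-below-order g (ℕ.≤-<-trans (ℕ.m∸n≤m b a) b<o) (^-∸ a≤b gᵃ≈gᵇ)))
    ... | inj₂ b≤a = ℕ.≤-antisym (ℕ.m∸n≡0⇒m≤n (^≈ε-below-order g (ℕ.≤-<-trans (ℕ.m∸n≤m a b) a<o) (^-∸ b≤a (≈-sym gᵃ≈gᵇ)))) b≤a

    order-∣ : ∀ g m → g ^ m ≈ ε → order g ∣ m
    order-∣ g m gᵐ≈ε = m%n≡0⇒n∣m m (order g)
      (^≈ε-below-order g (m%n<n m (order g)) (≈-trans (≈-sym (^-mod g m)) gᵐ≈ε))
      where open import Data.Nat.Divisibility using (m%n≡0⇒n∣m)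

    order-cong : ∀ {g h} → g ≈ h → order g ≡ order h
    order-cong {g} {h} g≈h = ∣-antisym (order-∣ g (order h) (≈-trans (^-cong (order h) g≈h) (^-order h)))
                                       (order-∣ h (order g) (≈-trans (^-cong (order g) (≈-sym g≈h)) (^-order g)))
      where open import Data.Nat.Divisibility using (∣-antisym)

    InCoset : Carrier → Carrier → Fin n → Set ℓ
    InCoset b g j = ∃ λ (a : Fin (order g)) → e j ≈ b ∙ g ^ toℕ a

    inCoset? : ∀ b g j → Dec (InCoset b g j)
    inCoset? b g j = any? (λ a → e j ≈? (b ∙ g ^ toℕ a))

    inCoset-^ : ∀ {b g j} m → e j ≈ b ∙ g ^ m → InCoset b g j
    inCoset-^ {b} {g} m eⱼ≈bgᵐ =
      fromℕ< (m%n<n m (order g)) ,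
      ≈-trans eⱼ≈bgᵐ (∙-congˡ (≈-trans (^-mod g m) (reflexive (≡.cong (g ^_) (≡.sym (toℕ-fromℕ< (m%n<n m (order g))))))))

    sumFin-coset : ∀ b g → sumFin (λ j → indicator (inCoset? b g j)) ≡ + order g
    sumFin-coset b g = sumFin-indicator-image (inCoset? b g) (λ a → index (b ∙ g ^ toℕ a))
      (λ a a′ eq → toℕ-injective (^-injective g (toℕ<n a) (toℕ<n a′) (∙-cancelˡ b _ _ (index-≈ eq))))
      (λ a → a , index-spec _)
      (λ j (a , eⱼ≈bgᵃ) → a , index-unique _ j eⱼ≈bgᵃ)

    module _ (g : Carrier) where
      private
        R : Fin n → Fin n → Set ℓ
        R i = InCoset (e i) g

        R-refl : ∀ i → R i i
        R-refl i = inCoset-^ 0 (≈-sym (identityʳ _))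

        R-sym : ∀ {i j} → R i j → R j i
        R-sym {i} {j} (a , eⱼ≈eᵢgᵃ) = inCoset-^ (order g ∸ toℕ a) (≈-sym (begin
          e j ∙ g ^ (order g ∸ toℕ a)               ≈⟨ ∙-congʳ eⱼ≈eᵢgᵃ ⟩
          (e i ∙ g ^ toℕ a) ∙ g ^ (order g ∸ toℕ a) ≈⟨ assoc _ _ _ ⟩
          e i ∙ (g ^ toℕ a ∙ g ^ (order g ∸ toℕ a)) ≈⟨ ∙-congˡ (≈-sym (^-+ g (toℕ a) _)) ⟩
          e i ∙ g ^ (toℕ a + (order g ∸ toℕ a))     ≡⟨ ≡.cong (λ k → e i ∙ g ^ k) (ℕ.m+[n∸m]≡n (ℕ.<⇒≤ (toℕ<n a))) ⟩
          e i ∙ g ^ order g                         ≈⟨ ∙-congˡ (^-order g) ⟩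
          e i ∙ ε                                   ≈⟨ identityʳ _ ⟩
          e i                                       ∎))
          where open ≈-Reasoning

        R-trans : ∀ {i j k} → R i j → R j k → R i k
        R-trans {i} {j} {k} (a , eⱼ≈eᵢgᵃ) (b , eₖ≈eⱼgᵇ) = inCoset-^ (toℕ a + toℕ b) (begin
          e k                            ≈⟨ eₖ≈eⱼgᵇ ⟩
          e j ∙ g ^ toℕ b                ≈⟨ ∙-congʳ eⱼ≈eᵢgᵃ ⟩
          (e i ∙ g ^ toℕ a) ∙ g ^ toℕ b  ≈⟨ assoc _ _ _ ⟩
          e i ∙ (g ^ toℕ a ∙ g ^ toℕ b)  ≈⟨ ∙-congˡ (≈-sym (^-+ g (toℕ a) (toℕ b))) ⟩
          e i ∙ g ^ (toℕ a + toℕ b)      ∎)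
          where open ≈-Reasoning

        representative : ∀ i → ∃ λ k → R i k × (∀ j → toℕ j < toℕ k → ¬ R i j)
        representative i = least (R i) (inCoset? (e i) g) (i , R-refl i)

        rep : Fin n → Fin n
        rep i = proj₁ (representative i)

        R-rep : ∀ i → R i (rep i)
        R-rep i = proj₁ (proj₂ (representative i))

        rep-cong : ∀ {i i′} → R i i′ → rep i ≡ rep i′
        rep-cong {i} {i′} Rii′ = least-unique
          (R-rep i) (proj₂ (proj₂ (representative i)))
          (R-trans Rii′ (R-rep i′)) (λ j j<k Rij → proj₂ (proj₂ (representative i′)) j j<k (R-trans (R-sym Rii′) Rij))

        fibre : ∀ r (rep-r≟r : Dec (rep r ≡ r)) →
                sumFin (λ i → indicator (rep i Fin.≟ r)) ≡ indicator rep-r≟r ℤ.* + order g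
        fibre r (yes rep-r≡r) = ≡.trans
          (sumFin-cong (λ i → indicator-cong (rep i Fin.≟ r) (inCoset? (e r) g i)
                               (λ rep-i≡r → R-sym (≡.subst (R i) rep-i≡r (R-rep i)))
                               (λ Rri → ≡.trans (rep-cong (R-sym Rri)) rep-r≡r)))
          (≡.trans (sumFin-coset (e r) g) (≡.sym (ℤ.*-identityˡ (+ order g))))
        fibre r (no rep-r≢r) = ≡.trans
          (sumFin-zero (λ i → indicator (rep i Fin.≟ r)) (λ i → indicator-no (rep i Fin.≟ r)
             (λ rep-i≡r → rep-r≢r (≡.trans (≡.sym (rep-cong (≡.subst (R i) rep-i≡r (R-rep i)))) rep-i≡r))))
          (≡.sym (ℤ.*-zeroˡ (+ order g)))

      -- Lagrange: the cosets of ⟨g⟩, each of size order g, partition G.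
      lagrange : order g ∣ n
      lagrange = divides (count reps?) (ℤ.+-injective (≡.trans (≡.sym sum≡n) (≡.trans sum≡ (≡.sym (ℤ.pos-* (count reps?) (order g))))))
        where
        reps? = λ r → rep r Fin.≟ r
        sum≡n : sumFin {n} (λ _ → 1ℤ) ≡ + n
        sum≡n = ≡.trans (sumFin-const {n} 1ℤ (λ _ → 1ℤ) (λ _ → ≡.refl)) (ℤ.*-identityʳ (+ n))
        sum≡ : sumFin {n} (λ _ → 1ℤ) ≡ + count reps? ℤ.* + order g
        sum≡ = begin
          sumFin {n} (λ _ → 1ℤ)                                         ≡⟨ sumFin-cong (λ i → ≡.sym (sumFin-indicator-≟ (rep i))) ⟩
          sumFin (λ i → sumFin (λ r → indicator (rep i Fin.≟ r)))       ≡⟨ sumFin-swap (λ i r → indicator (rep i Fin.≟ r)) ⟩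
          sumFin (λ r → sumFin (λ i → indicator (rep i Fin.≟ r)))       ≡⟨ sumFin-cong (λ r → fibre r (reps? r)) ⟩
          sumFin (λ r → indicator (reps? r) ℤ.* + order g)              ≡⟨ sumFin-cong (λ r → ℤ.*-comm (indicator (reps? r)) _) ⟩
          sumFin (λ r → + order g ℤ.* indicator (reps? r))              ≡⟨ sumFin-*ˡ (+ order g) (λ r → indicator (reps? r)) ⟩
          + order g ℤ.* sumFin (λ r → indicator (reps? r))              ≡⟨ ℤ.*-comm (+ order g) _ ⟩
          sumFin (λ r → indicator (reps? r)) ℤ.* + order g              ≡⟨ ≡.cong (ℤ._* + order g) (sumFin-indicator reps?) ⟩
          + count reps? ℤ.* + order g                                   ∎
          where open ≡.≡-Reasoning

    positive-power : ∀ {u v} m → u ≈ v ^ m → ¬ u ≈ ε → ∃ λ k → u ≈ v ^ suc k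
    positive-power zero    u≈ε u≉ε = ⊥-elim (u≉ε u≈ε)
    positive-power (suc k) u≈vᵏ _  = k , u≈vᵏ

    power-inverse : ∀ {u v r} m k l → v ≈ u ^ r → m * r + k * order u ≡ 1 + l * order u → u ≈ v ^ m
    power-inverse {u} {v} {r} m k l v≈uʳ exponents = ≈-sym (begin
      v ^ m                      ≈⟨ ^-cong m v≈uʳ ⟩
      (u ^ r) ^ m                ≈⟨ ^-* u r m ⟩
      u ^ (m * r)                ≈⟨ ≈-sym (^-periodic (^-order u) (m * r) k) ⟩
      u ^ (m * r + k * order u)  ≡⟨ ≡.cong (u ^_) exponents ⟩
      u ^ (1 + l * order u)      ≈⟨ ^-periodic (^-order u) 1 l ⟩
      u ∙ ε                      ≈⟨ identityʳ u ⟩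
      u                          ∎)
      where open ≈-Reasoning

    -- The exponent a is inverted modulo the prime order by Bézout's identity.
    prime-order-generated : ∀ {u v} → Prime (order u) → ∀ a → v ≈ u ^ a → ¬ v ≈ ε → ∃ λ k → u ≈ v ^ suc k
    prime-order-generated {u} {v} order-prime a v≈uᵃ v≉ε =
      generated (a % order u) (m%n<n a (order u)) (≈-trans v≈uᵃ (^-mod u a))
      where
      u≉ε : ¬ u ≈ ε
      u≉ε u≈ε with ^≈ε-below-order u (ℕ.nonTrivial⇒n>1 (order u) {{prime⇒nonTrivial order-prime}}) (≈-trans (identityʳ u) u≈ε)
      ... | ()
      p′ = ℕ.pred (order u)
      generated : ∀ r → r < order u → v ≈ u ^ r → ∃ λ k → u ≈ v ^ suc k
      generated zero     _   v≈u⁰ = ⊥-elim (v≉ε v≈u⁰)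
      generated (suc r′) r<o v≈uʳ with coprime-Bézout (prime⇒coprime order-prime r<o)
      ... | Bézout.-+ x y eq = positive-power y (power-inverse y 0 x v≈uʳ (≡.trans (ℕ.+-identityʳ _) (≡.sym eq))) u≉ε
      ... | Bézout.+- x y eq = positive-power (p′ * y) (power-inverse (p′ * y) 1 (p′ * x) v≈uʳ exponents) u≉ε
        where
        open import Data.Nat.Tactic.RingSolver using (solve-∀)
        expand : ∀ p′ y r′ → p′ * y * suc r′ + 1 * suc p′ ≡ suc (p′ * (1 + y * suc r′))
        expand = solve-∀
        regroup : ∀ p′ x → suc (p′ * (x * suc p′)) ≡ 1 + p′ * x * suc p′
        regroup = solve-∀
        exponents : p′ * y * suc r′ + 1 * order u ≡ 1 + p′ * x * order u
        exponents = ≡.subst (λ o → p′ * y * suc r′ + 1 * o ≡ 1 + p′ * x * o) (≡.sym (order≡suc u))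
          (≡.trans (expand p′ y r′) (≡.trans (≡.cong (λ z → suc (p′ * z)) (≡.trans eq (≡.cong (x *_) (order≡suc u))))
                                             (regroup p′ x)))

module PowerGraph where

  open import Defs
  open Sums
  open Determinant using (δ-diag; δ-off)
  open Weighted
  open GroupOrder
  open import Data.Nat as ℕ using (ℕ; suc; _<_; s≤s)
  import Data.Nat.Properties as ℕ
  open import Data.Nat.Divisibility using (_∣_; divides; *-cancelˡ-∣)
  open import Data.Nat.GCD using (gcd[m,n]∣m; gcd[m,n]∣n)
  open import Data.Nat.Coprimality using (gcd≡1⇒coprime; coprime-divisor)
  open import Data.Nat.Primality using (Prime; prime⇒irreducible; prime⇒nonZero)
  open import Data.Nat.Tactic.RingSolver using () renaming (solve-∀ to ℕ-solve-∀)
  open import Data.Fin using (Fin; _≟_)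
  open import Data.Fin.Properties using (any?)
  open import Data.Integer as ℤ using (ℤ; +_; _+_; _-_; _*_; 0ℤ; 1ℤ)
  import Data.Integer.Properties as ℤ
  open import Data.Integer.Tactic.RingSolver using (solve-∀)
  open import Data.Product using (∃; _,_; _×_)
  open import Data.Sum using (_⊎_; inj₁; inj₂; [_,_]′)
  open import Function using (id)
  open import Data.List using ([]; _∷_)
  open import Data.Empty using (⊥-elim)
  open import Relation.Nullary using (¬_; Dec; yes; no)
  open import Relation.Binary.PropositionalEquality as ≡ using (_≡_; _≢_)
  open import Algebra.Bundles using (Group)

  -- gcd d p is 1 or p: either d divides p, or d = q p with q dividing p.
  divisor-of-prime-square : ∀ {p d} → Prime p → d ∣ p ℕ.* p → d ≡ 1 ⊎ d ≡ p ⊎ d ≡ p ℕ.* p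
  divisor-of-prime-square {p} {d} p-prime d∣p² with prime⇒irreducible p-prime (gcd[m,n]∣n d p)
  ... | inj₁ gcd≡1 with prime⇒irreducible p-prime (coprime-divisor (gcd≡1⇒coprime gcd≡1) d∣p²)
  ...   | inj₁ d≡1 = inj₁ d≡1
  ...   | inj₂ d≡p = inj₂ (inj₁ d≡p)
  divisor-of-prime-square {p} {d} p-prime d∣p² | inj₂ gcd≡p with ≡.subst (_∣ d) gcd≡p (gcd[m,n]∣m d p)
  ...   | divides q d≡qp with prime⇒irreducible p-prime
                               (*-cancelˡ-∣ p {{prime⇒nonZero p-prime}} (≡.subst (_∣ p ℕ.* p) (≡.trans d≡qp (ℕ.*-comm q p)) d∣p²))
  ...     | inj₁ q≡1 = inj₂ (inj₁ (≡.trans d≡qp (≡.trans (≡.cong (ℕ._* p) q≡1) (ℕ.*-identityˡ p))))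
  ...     | inj₂ q≡p = inj₂ (inj₂ (≡.trans d≡qp (≡.cong (ℕ._* p) q≡p)))

  -- A windmill on p² vertices whose blades have p - 1 vertices has p + 1 blades.
  windmill-blade-count : ∀ q k → + (suc (suc q) ℕ.* suc (suc q)) ≡ 1ℤ + + suc k * (+ suc (suc q) - 1ℤ) → k ≡ suc (suc q)
  windmill-blade-count q k eq = ℕ.suc-injective (≡.sym (ℕ.*-cancelʳ-≡ (suc (suc (suc q))) (suc k) (suc q)
    (ℕ.suc-injective (≡.trans (≡.sym (square q)) (ℤ.+-injective (≡.trans eq rhs))))))
    where
    rhs : 1ℤ + + suc k * (+ suc (suc q) - 1ℤ) ≡ + suc (suc k ℕ.* suc q)
    rhs = ≡.trans (≡.cong (_+_ 1ℤ) (≡.sym (ℤ.pos-* (suc k) (suc q)))) (≡.sym (ℤ.pos-+ 1 (suc k ℕ.* suc q)))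
    square : ∀ q → suc (suc q) ℕ.* suc (suc q) ≡ suc (suc (suc (suc q)) ℕ.* suc q)
    square = ℕ-solve-∀

  windmill-exponent : ∀ q e m → suc (suc m) ≡ suc (suc q) ℕ.* suc (suc q) → e ℕ.+ suc (suc q) ≡ m →
                      e ≡ (suc (suc q) ℕ.+ 1) ℕ.* q
  windmill-exponent q e m 2+m≡p² e+p≡m = ℕ.+-cancelʳ-≡ (suc (suc q)) e _
    (ℕ.suc-injective (ℕ.suc-injective (≡.trans (≡.cong (λ k → suc (suc k)) e+p≡m) (≡.trans 2+m≡p² (expand q)))))
    where
    expand : ∀ q → suc (suc q) ℕ.* suc (suc q) ≡ suc (suc ((suc (suc q) ℕ.+ 1) ℕ.* q ℕ.+ suc (suc q)))
    expand = ℕ-solve-∀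

  -- The prime is written p = q + 2, so that p * p is visibly of the form 2 + m.
  module OfOrderPrimeSquare {c ℓ} (G : Group c ℓ) (q : ℕ) (p-prime : Prime (suc (suc q)))
    (e : Fin (suc (suc q) ℕ.* suc (suc q)) → Group.Carrier G) (enum : IsEnumeration G e)
    (A : Matrix (suc (suc q) ℕ.* suc (suc q))) (adjacency : IsPowerAdjMatrix G e A) where

    open Group G renaming (refl to ≈-refl; sym to ≈-sym; trans to ≈-trans) hiding (_-_)
    open Order G e enum

    p n : ℕ
    p = suc (suc q)
    n = p ℕ.* p

    Adj : Fin n → Fin n → Set ℓ
    Adj i j = PowerAdj G (e i) (e j)

    A-adjacent : ∀ {i j} → Adj i j → A i j ≡ 1ℤ
    A-adjacent {i} {j} adj with adjacency i j
    ... | inj₁ (Aᵢⱼ≡1 , _)   = Aᵢⱼ≡1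
    ... | inj₂ (_ , ¬adj)    = ⊥-elim (¬adj adj)

    A-nonadjacent : ∀ {i j} → ¬ Adj i j → A i j ≡ 0ℤ
    A-nonadjacent {i} {j} ¬adj with adjacency i j
    ... | inj₁ (_ , adj)     = ⊥-elim (¬adj adj)
    ... | inj₂ (Aᵢⱼ≡0 , _)   = Aᵢⱼ≡0

    A-binary : ∀ i j → A i j ≡ 0ℤ ⊎ A i j ≡ 1ℤ
    A-binary i j with adjacency i j
    ... | inj₁ (Aᵢⱼ≡1 , _) = inj₂ Aᵢⱼ≡1
    ... | inj₂ (Aᵢⱼ≡0 , _) = inj₁ Aᵢⱼ≡0

    A-cong : ∀ {i j k l} → (Adj i j → Adj k l) → (Adj k l → Adj i j) → A i j ≡ A k l
    A-cong {i} {j} to from with adjacency i j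
    ... | inj₁ (Aᵢⱼ≡1 , adj)  = ≡.trans Aᵢⱼ≡1 (≡.sym (A-adjacent (to adj)))
    ... | inj₂ (Aᵢⱼ≡0 , ¬adj) = ≡.trans Aᵢⱼ≡0 (≡.sym (A-nonadjacent (λ adj → ¬adj (from adj))))

    PowerAdj-sym : ∀ {u v} → PowerAdj G u v → PowerAdj G v u
    PowerAdj-sym (u≉v , inj₁ u∈v) = (λ v≈u → u≉v (≈-sym v≈u)) , inj₂ u∈v
    PowerAdj-sym (u≉v , inj₂ v∈u) = (λ v≈u → u≉v (≈-sym v≈u)) , inj₁ v∈u

    A-symmetric : ∀ i j → A i j ≡ A j i
    A-symmetric i j = A-cong PowerAdj-sym PowerAdj-sym

    A-loopless : ∀ i → A i i ≡ 0ℤ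
    A-loopless i = A-nonadjacent (λ (eᵢ≉eᵢ , _) → eᵢ≉eᵢ ≈-refl)

    e-distinct : ∀ {i j} → i ≢ j → ¬ e i ≈ e j
    e-distinct i≢j eᵢ≈eⱼ = i≢j (e-injective _ _ eᵢ≈eⱼ)

    OrderCases : Carrier → Set
    OrderCases g = order g ≡ 1 ⊎ order g ≡ p ⊎ order g ≡ n

    order-cases : ∀ g → OrderCases g
    order-cases g = divisor-of-prime-square p-prime (lagrange g)

    order≡1 : ∀ g → order g ≡ 1 → g ≈ ε
    order≡1 g order-g≡1 = ≈-trans (≈-sym (identityʳ g)) (≈-trans (reflexive (≡.cong (g ^_) (≡.sym order-g≡1))) (^-order g))

    _∈⟨_⟩ : Carrier → Carrier → Set ℓ
    v ∈⟨ u ⟩ = ∃ λ m → v ≈ u ^ m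

    ∈⟨⟩-trans : ∀ {u v w} → v ∈⟨ u ⟩ → w ∈⟨ v ⟩ → w ∈⟨ u ⟩
    ∈⟨⟩-trans {u} (a , v≈uᵃ) (b , w≈vᵇ) = b ℕ.* a , ≈-trans w≈vᵇ (≈-trans (^-cong b v≈uᵃ) (^-* u a b))

    isPosPower : ∀ {u v} k → v ≈ u ^ suc k → IsPosPower G v u
    isPosPower {u} k v≈uᵏ = k , ≈-trans v≈uᵏ (reflexive (≡.sym (pow≡^ (suc k) u)))

    power⇒IsPosPower : ∀ {u v} → v ∈⟨ u ⟩ → ¬ v ≈ ε → IsPosPower G v u
    power⇒IsPosPower (m , v≈uᵐ) v≉ε = let k , v≈uᵏ = positive-power m v≈uᵐ v≉ε in isPosPower k v≈uᵏ

    ε-IsPosPower : ∀ {w} u → w ≈ ε → IsPosPower G w u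
    ε-IsPosPower u w≈ε = isPosPower (ℕ.pred (order u))
      (≈-trans w≈ε (≈-sym (≈-trans (reflexive (≡.cong (u ^_) (≡.sym (order≡suc u)))) (^-order u))))

    IsPosPower⇒∈ : ∀ {u v} → IsPosPower G v u → v ∈⟨ u ⟩
    IsPosPower⇒∈ {u} (k , v≈uᵏ) = suc k , ≈-trans v≈uᵏ (reflexive (pow≡^ (suc k) u))

    InCoset-ε⇒∈ : ∀ {g j} → InCoset ε g j → e j ∈⟨ g ⟩
    InCoset-ε⇒∈ (a , eⱼ≈εgᵃ) = toℕ a , ≈-trans eⱼ≈εgᵃ (identityˡ _)
      where open Data.Fin using (toℕ)

    ∈⇒InCoset-ε : ∀ {g j} → e j ∈⟨ g ⟩ → InCoset ε g j
    ∈⇒InCoset-ε (m , eⱼ≈gᵐ) = inCoset-^ m (≈-trans eⱼ≈gᵐ (≈-sym (identityˡ _)))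

    generator : ∀ {g} → order g ≡ n → ∀ v → v ∈⟨ g ⟩
    generator {g} order-g v = let m , e-index≈gᵐ = InCoset-ε⇒∈ (coset-full (index v)) in
                              m , ≈-trans (≈-sym (index-spec v)) e-index≈gᵐ
      where
      coset-full : ∀ j → InCoset ε g j
      coset-full = sumFin-indicator-full (inCoset? ε g) (≡.trans (sumFin-coset ε g) (≡.cong +_ order-g))

    module Cyclic (g : Carrier) (order-g : order g ≡ n) where

      -- h generates the unique subgroup of order p.
      h : Carrier
      h = g ^ p

      h≉ε : ¬ h ≈ ε
      h≉ε h≈ε = ℕ.1+n≢0 (^≈ε-below-order g p<order h≈ε)
        where
        p<order : p < order g
        p<order = ≡.subst (p <_) (≡.sym order-g) (ℕ.m<m+n p (s≤s ℕ.z≤n))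

      order-h : order h ≡ p
      order-h = [ (λ order-h≡1 → ⊥-elim (h≉ε (order≡1 h order-h≡1))) , id ]′
                  (prime⇒irreducible p-prime (order-∣ h p hᵖ≈ε))
        where
        hᵖ≈ε : h ^ p ≈ ε
        hᵖ≈ε = ≈-trans (^-* g p p) (≈-trans (reflexive (≡.cong (g ^_) (≡.sym order-g))) (^-order g))

      order-p⇒∈⟨h⟩ : ∀ w → order w ≡ p → w ∈⟨ h ⟩
      order-p⇒∈⟨h⟩ w order-w =
        let a , w≈gᵃ = generator order-g w
            divides b a≡bp = *-cancelˡ-∣ {p} {a} p (≡.subst (_∣ p ℕ.* a) order-g (order-∣ g (p ℕ.* a) (gᵖᵃ≈ε a w≈gᵃ)))
        in b , ≈-trans w≈gᵃ (≈-trans (reflexive (≡.cong (g ^_) a≡bp)) (≈-sym (^-* g p b)))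
        where
        gᵖᵃ≈ε : ∀ a → w ≈ g ^ a → g ^ (p ℕ.* a) ≈ ε
        gᵖᵃ≈ε a w≈gᵃ = begin
          g ^ (p ℕ.* a)  ≈⟨ ^-* g a p ⟨
          (g ^ a) ^ p    ≈⟨ ^-cong p w≈gᵃ ⟨
          w ^ p          ≡⟨ ≡.cong (w ^_) order-w ⟨
          w ^ order w    ≈⟨ ^-order w ⟩
          ε              ∎
          where open ≈-Reasoning

      order-p⇒power : ∀ {u v} → order u ≡ p → order v ≡ p → ¬ u ≈ ε → v ∈⟨ u ⟩
      order-p⇒power {u} {v} order-u order-v u≉ε =
        let a , u≈hᵃ = order-p⇒∈⟨h⟩ u order-u
            b , v≈hᵇ = order-p⇒∈⟨h⟩ v order-v
            k , h≈uᵏ = prime-order-generated (≡.subst Prime (≡.sym order-h) p-prime) a u≈hᵃ u≉ε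
        in ∈⟨⟩-trans (suc k , h≈uᵏ) (b , v≈hᵇ)

      complete : ∀ i j → i ≢ j → Adj i j
      complete i j i≢j = e-distinct i≢j , power (e i ≈? ε) (e j ≈? ε)
        where
        power : Dec (e i ≈ ε) → Dec (e j ≈ ε) → IsPosPower G (e i) (e j) ⊎ IsPosPower G (e j) (e i)
        power (yes eᵢ≈ε) _          = inj₁ (ε-IsPosPower (e j) eᵢ≈ε)
        power (no _)     (yes eⱼ≈ε) = inj₂ (ε-IsPosPower (e i) eⱼ≈ε)
        power (no eᵢ≉ε)  (no eⱼ≉ε)  = orders (order-cases (e i)) (order-cases (e j))
          where
          orders : OrderCases (e i) → OrderCases (e j) → IsPosPower G (e i) (e j) ⊎ IsPosPower G (e j) (e i)
          orders (inj₁ order-i≡1)       _                      = ⊥-elim (eᵢ≉ε (order≡1 (e i) order-i≡1))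
          orders _                      (inj₁ order-j≡1)       = ⊥-elim (eⱼ≉ε (order≡1 (e j) order-j≡1))
          orders (inj₂ (inj₂ order≡n)) _                      = inj₂ (power⇒IsPosPower (generator order≡n (e j)) eⱼ≉ε)
          orders (inj₂ (inj₁ _))        (inj₂ (inj₂ order≡n)) = inj₁ (power⇒IsPosPower (generator order≡n (e i)) eᵢ≉ε)
          orders (inj₂ (inj₁ order-i))  (inj₂ (inj₁ order-j)) = inj₂ (power⇒IsPosPower (order-p⇒power order-i order-j eᵢ≉ε) eⱼ≉ε)


      spectrum : HasSpectrum (laplacian A) ((+ 0 , 1) ∷ (+ n , n ℕ.∸ 1) ∷ [])
      spectrum x = ≡.trans (charPoly-laplacian A x A-loopless)
        (≡.trans (det-weighted-complete (x - + n) _ A (λ _ → 1ℤ) (λ i j i≢j → A-adjacent (complete i j i≢j)) degree)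
                 (≡.trans (≡.cong (λ s → (x - + n) ℤ.^ (n ℕ.∸ 1) * ((x - + n) + s)) (≡.trans (sumFin-const {n} 1ℤ (λ _ → 1ℤ) (λ _ → ≡.refl)) (ℤ.*-identityʳ (+ n))))
                          (regroup x (+ n) ((x - + n) ℤ.^ (n ℕ.∸ 1)))))
        where
        regroup : ∀ x N Y → Y * ((x - N) + N) ≡ ((x - + 0) * 1ℤ) * (Y * 1ℤ)
        regroup = solve-∀
        shift : ∀ x k → x - k ≡ (x - (1ℤ + k)) + 1ℤ
        shift = solve-∀
        degree : ∀ i → x - sumFin (A i) ≡ (x - + n) + 1ℤ
        degree i = ≡.trans (≡.cong (x -_) (sumFin-all-but-one (A i) i (A-loopless i)
                                            (λ j j≢i → A-adjacent (complete i j (λ i≡j → j≢i (≡.sym i≡j))))))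
                           (shift x (+ ℕ.pred n))

    module Noncyclic (noncyclic : ∀ g → order g ≢ n) where

      order-p : ∀ {g} → ¬ g ≈ ε → order g ≡ p
      order-p {g} g≉ε = [ (λ order-g≡1 → ⊥-elim (g≉ε (order≡1 g order-g≡1))) ,
                          [ id , (λ order-g≡n → ⊥-elim (noncyclic g order-g≡n)) ]′ ]′ (order-cases g)

      power-sym : ∀ {u v} → ¬ u ≈ ε → ¬ v ≈ ε → v ∈⟨ u ⟩ → u ∈⟨ v ⟩
      power-sym {u} u≉ε v≉ε (m , v≈uᵐ) =
        let k , u≈vᵏ = prime-order-generated (≡.subst Prime (≡.sym (order-p u≉ε)) p-prime) m v≈uᵐ v≉ε
        in suc k , u≈vᵏ

      PowerAdj⇒∈ : ∀ {u v} → ¬ u ≈ ε → ¬ v ≈ ε → PowerAdj G u v → v ∈⟨ u ⟩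
      PowerAdj⇒∈ u≉ε v≉ε (_ , inj₁ u∈v) = power-sym v≉ε u≉ε (IsPosPower⇒∈ u∈v)
      PowerAdj⇒∈ u≉ε v≉ε (_ , inj₂ v∈u) = IsPosPower⇒∈ v∈u

      ∈⇒PowerAdj : ∀ {u v} → ¬ u ≈ v → ¬ v ≈ ε → v ∈⟨ u ⟩ → PowerAdj G u v
      ∈⇒PowerAdj u≉v v≉ε v∈u = u≉v , inj₂ (power⇒IsPosPower v∈u v≉ε)

      hub : Fin n
      hub = index ε

      leaf≉ε : ∀ {i} → i ≢ hub → ¬ e i ≈ ε
      leaf≉ε i≢hub eᵢ≈ε = i≢hub (≡.sym (index-unique ε _ eᵢ≈ε))

      hub-adjacent : ∀ j → j ≢ hub → Adj hub j
      hub-adjacent j j≢hub = e-distinct (λ hub≡j → j≢hub (≡.sym hub≡j)) , inj₁ (ε-IsPosPower (e j) (index-spec ε))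

      leaf-transitive : ∀ i j k → i ≢ j → i ≢ k → j ≢ k → i ≢ hub → j ≢ hub → k ≢ hub →
                        A i j ≡ 1ℤ → A i k ≡ A j k
      leaf-transitive i j k i≢j i≢k j≢k i≢hub j≢hub k≢hub Aᵢⱼ≡1 = A-cong
        (λ adj-ik → ∈⇒PowerAdj (e-distinct j≢k) (leaf≉ε k≢hub) (∈⟨⟩-trans eᵢ∈eⱼ (PowerAdj⇒∈ (leaf≉ε i≢hub) (leaf≉ε k≢hub) adj-ik)))
        (λ adj-jk → ∈⇒PowerAdj (e-distinct i≢k) (leaf≉ε k≢hub) (∈⟨⟩-trans eⱼ∈eᵢ (PowerAdj⇒∈ (leaf≉ε j≢hub) (leaf≉ε k≢hub) adj-jk)))
        where
        adj-ij : Adj i j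
        adj-ij with adjacency i j
        ... | inj₁ (_ , adj)     = adj
        ... | inj₂ (Aᵢⱼ≡0 , _)   = ⊥-elim (0≢1 (≡.trans (≡.sym Aᵢⱼ≡0) Aᵢⱼ≡1))
          where
          0≢1 : 0ℤ ≢ 1ℤ
          0≢1 ()
        eⱼ∈eᵢ : e j ∈⟨ e i ⟩
        eⱼ∈eᵢ = PowerAdj⇒∈ (leaf≉ε i≢hub) (leaf≉ε j≢hub) adj-ij
        eᵢ∈eⱼ : e i ∈⟨ e j ⟩
        eᵢ∈eⱼ = power-sym (leaf≉ε i≢hub) (leaf≉ε j≢hub) eⱼ∈eᵢ

      closed-neighbourhood : ∀ i → i ≢ hub → ∀ j → (δ i j + A i j) * 1ℤ ≡ indicator (inCoset? ε (e i) j)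
      closed-neighbourhood i i≢hub j with j ≟ i
      ... | yes j≡i = ≡.trans (≡.cong₂ (λ d a → (d + a) * 1ℤ) (≡.trans (≡.cong (δ i) j≡i) (δ-diag i)) (≡.trans (≡.cong (A i) j≡i) (A-loopless i)))
                              (≡.sym (indicator-yes (inCoset? ε (e i) j) (∈⇒InCoset-ε (1 , ≈-trans (reflexive (≡.cong e j≡i)) (≈-sym (identityʳ _))))))
      ... | no j≢i  = ≡.trans (≡.cong (λ d → (d + A i j) * 1ℤ) (δ-off i j (λ i≡j → j≢i (≡.sym i≡j))))
                              (≡.trans (ℤ.*-identityʳ _) (≡.trans (ℤ.+-identityˡ _)
                                       (indicator-agrees (adjacency i j) (inCoset? ε (e i) j))))
        where
        in-⟨eᵢ⟩⇒Adj : InCoset ε (e i) j → Adj i j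
        in-⟨eᵢ⟩⇒Adj in-coset with e j ≈? ε
        ... | yes eⱼ≈ε = e-distinct (λ i≡j → j≢i (≡.sym i≡j)) , inj₂ (ε-IsPosPower (e i) eⱼ≈ε)
        ... | no eⱼ≉ε  = ∈⇒PowerAdj (e-distinct (λ i≡j → j≢i (≡.sym i≡j))) eⱼ≉ε (InCoset-ε⇒∈ in-coset)
        Adj⇒in-⟨eᵢ⟩ : Adj i j → InCoset ε (e i) j
        Adj⇒in-⟨eᵢ⟩ adj with e j ≈? ε
        ... | yes eⱼ≈ε = ∈⇒InCoset-ε (0 , eⱼ≈ε)
        ... | no eⱼ≉ε  = ∈⇒InCoset-ε (PowerAdj⇒∈ (leaf≉ε i≢hub) eⱼ≉ε adj)
        indicator-agrees : (A i j ≡ 1ℤ × Adj i j) ⊎ (A i j ≡ 0ℤ × ¬ Adj i j) → (d : Dec (InCoset ε (e i) j)) → A i j ≡ indicator d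
        indicator-agrees (inj₁ (Aᵢⱼ≡1 , adj)) d  = ≡.trans Aᵢⱼ≡1 (≡.sym (indicator-yes d (Adj⇒in-⟨eᵢ⟩ adj)))
        indicator-agrees (inj₂ (Aᵢⱼ≡0 , ¬adj)) d = ≡.trans Aᵢⱼ≡0 (≡.sym (indicator-no d (λ c → ¬adj (in-⟨eᵢ⟩⇒Adj c))))

      closed-weight : ∀ i → i ≢ hub → sumFin (λ j → (δ i j + A i j) * 1ℤ) ≡ + p
      closed-weight i i≢hub = ≡.trans (sumFin-cong (closed-neighbourhood i i≢hub))
                                      (≡.trans (sumFin-coset ε (e i)) (≡.cong +_ (order-p (leaf≉ε i≢hub))))

      leaf-degree : ∀ i → i ≢ hub → sumFin (A i) ≡ + p - 1ℤ
      leaf-degree i i≢hub = ≡.trans (solve-shift (sumFin (A i))) (≡.cong (_- 1ℤ) (≡.trans closed≡ (closed-weight i i≢hub)))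
        where
        solve-shift : ∀ d → d ≡ (1ℤ + d) - 1ℤ
        solve-shift = solve-∀
        closed≡ : 1ℤ + sumFin (A i) ≡ sumFin (λ j → (δ i j + A i j) * 1ℤ)
        closed≡ = ≡.sym (≡.trans (sumFin-cong (λ j → ℤ.*-identityʳ (δ i j + A i j)))
                        (≡.trans (sumFin-+ (δ i) (A i))
                                 (≡.cong (_+ sumFin (A i)) (≡.trans (sumFin-single (δ i) i (λ j j≢i → δ-off i j (λ i≡j → j≢i (≡.sym i≡j))))
                                                                    (δ-diag i)))))

      hub-row : ∀ j → j ≢ hub → A hub j ≡ 1ℤ
      hub-row j j≢hub = A-adjacent (hub-adjacent j j≢hub)

      windmill : ∀ x → IsWindmill x (+ p) (+ n) (λ i → x - sumFin (A i)) A (λ _ → 1ℤ) hub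
      windmill x = record
        { hub-row            = hub-row
        ; hub-column         = λ j j≢hub → ≡.trans (A-symmetric j hub) (hub-row j j≢hub)
        ; loopless           = A-loopless
        ; symmetric          = A-symmetric
        ; leaf-edge          = λ i j _ _ _ → A-binary i j
        ; leaf-transitive    = leaf-transitive
        ; leaf-diag          = λ i i≢hub → ≡.trans (≡.cong (x -_) (leaf-degree i i≢hub)) (shift x (+ p))
        ; hub-diag           = ≡.trans (≡.cong (x -_) (sumFin-all-but-one (A hub) hub (A-loopless hub) hub-row))
                                       (shift′ x (+ ℕ.pred n))
        ; hub-weight         = ≡.refl
        ; leaf-closed-weight = closed-weight
        ; total-weight       = ≡.trans (sumFin-const {n} 1ℤ (λ _ → 1ℤ) (λ _ → ≡.refl)) (ℤ.*-identityʳ (+ n))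
        }
        where
        shift : ∀ x k → x - (k - 1ℤ) ≡ (x - k) + 1ℤ
        shift = solve-∀
        shift′ : ∀ x k → x - k ≡ (x - (1ℤ + k)) + 1ℤ
        shift′ = solve-∀

      spectrum : HasSpectrum (laplacian A) ((+ 0 , 1) ∷ (+ 1 , p) ∷ (+ p , (p ℕ.+ 1) ℕ.* (p ℕ.∸ 2)) ∷ (+ n , 1) ∷ [])
      spectrum x =
        let r , k , r+k≡m , blades , det≡ = det-weighted-windmill _ x (+ p) (+ n) _ A (λ _ → 1ℤ) hub (windmill x)
            k≡p = windmill-blade-count q k blades
            r≡ = windmill-exponent q r _ ≡.refl (≡.subst (λ k → r ℕ.+ k ≡ _) k≡p r+k≡m)
        in ≡.trans (charPoly-laplacian A x A-loopless)
                   (≡.trans det≡ (≡.trans (≡.cong₂ (λ r k → (x - + p) ℤ.^ r * ((x - 1ℤ) ℤ.^ k * (x * (x - + n)))) r≡ k≡p)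
                                          (regroup x (+ n) ((x - + p) ℤ.^ ((p ℕ.+ 1) ℕ.* (p ℕ.∸ 2))) ((x - 1ℤ) ℤ.^ p))))
        where
        regroup : ∀ x N E K → E * (K * (x * (x - N))) ≡ ((x - + 0) * 1ℤ) * (K * (E * (((x - N) * 1ℤ) * 1ℤ)))
        regroup = solve-∀

    spectrum : HasSpectrum (laplacian A) ((+ 0 , 1) ∷ (+ n , n ℕ.∸ 1) ∷ [])
             ⊎ HasSpectrum (laplacian A) ((+ 0 , 1) ∷ (+ 1 , p) ∷ (+ p , (p ℕ.+ 1) ℕ.* (p ℕ.∸ 2)) ∷ (+ n , 1) ∷ [])
    spectrum with any? (λ i → order (e i) ℕ.≟ n)
    ... | yes (i , cyclic) = inj₁ (Cyclic.spectrum (e i) cyclic)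
    ... | no noncyclic     = inj₂ (Noncyclic.spectrum λ g order-g →
                                    noncyclic (index g , ≡.trans (order-cong (index-spec g)) order-g))

open import Defs
open import Data.Nat using (ℕ; _*_; _+_; _∸_)
open import Data.Nat.Primality using (Prime)
open import Data.Fin using (Fin)
open import Data.Integer using (ℤ; +_)
open import Data.Product using (_×_; _,_)
open import Data.Sum using (_⊎_)
open import Data.List using (List; []; _∷_)
open import Algebra.Bundles using (Group)
open import Data.Nat using (zero; suc)
open import Data.Nat.Primality using (¬prime[0]; ¬prime[1])
open import Data.Empty using (⊥-elim)
open PowerGraph using (module OfOrderPrimeSquare)

proposition3p26 : ∀ {c ℓ} (G : Group c ℓ) (p : ℕ) → Prime p →
    (e : Fin (p * p) → Group.Carrier G) → IsEnumeration G e →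
    (A : Fin (p * p) → Fin (p * p) → ℤ) → IsPowerAdjMatrix G e A →
    HasSpectrum (laplacian A) ((+ 0 , 1) ∷ (+ (p * p) , p * p ∸ 1) ∷ [])
    ⊎ HasSpectrum (laplacian A)
        ((+ 0 , 1) ∷ (+ 1 , p) ∷ (+ p , (p + 1) * (p ∸ 2)) ∷ (+ (p * p) , 1) ∷ [])
proposition3p26 G zero          p-prime = ⊥-elim (¬prime[0] p-prime)
proposition3p26 G (suc zero)    p-prime = ⊥-elim (¬prime[1] p-prime)
proposition3p26 G (suc (suc q)) p-prime = OfOrderPrimeSquare.spectrum G q p-prime
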